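{- Let $F$ be a finite field and $n$ a positive integer. The unitary Cayley graph $\mathrm{Cay}(M_n(F), GL_n(F))$ is a strongly regular graph if and only if $n=2$.
   Context: $M_n(F)$ denotes the algebra of $n\times n$ matrices over $F$ and $GL_n(F)$ the group of invertible matrices in it. The unitary Cayley graph $\mathrm{Cay}(M_n(F),GL_n(F))$ is the graph with vertex set $M_n(F)$ in which $\{A,B\}$ is an edge iff $A-B\in GL_n(F)$. A strongly regular graph with parameters $(v,k,\lambda,\mu)$ is a graph on $v$ vertices in which every vertex has exactly $k$ neighbours, any two adjacent vertices have exactly $\lambda$ common neighbours, and any two distinct non-adjacent vertices have exactly $\mu$ common neighbours. -}

module Defs where

open import Level using (Level; _⊔_)
open import Data.Nat using (ℕ; zero; suc)
open import Data.Fin using (Fin; zero; suc)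
import Data.Fin as Fin
open import Data.Product using (Σ; ∃; _×_; _,_)
open import Data.Unit.Polymorphic using (⊤)
open import Relation.Nullary using (¬_; yes; no)
open import Relation.Binary.Core using (Rel)
open import Relation.Binary.Definitions using (Decidable)
open import Relation.Binary.PropositionalEquality using (_≡_)
open import Algebra.Bundles using (CommutativeRing)

record FiniteField (c ℓ : Level) : Set (Level.suc (c ⊔ ℓ)) where
  field
    commutativeRing : CommutativeRing c ℓ
  open CommutativeRing commutativeRing public
  field
    0≉1      : ¬ (0# ≈ 1#)
    inverse  : ∀ x → ¬ (x ≈ 0#) → ∃ λ y → (x * y) ≈ 1#
    _≟_      : Decidable _≈_
    size     : ℕ
    enum     : Fin size → Carrier
    enum-inj : ∀ i j → enum i ≈ enum j → i ≡ j
    enum-sur : ∀ x → ∃ λ i → x ≈ enum i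

HasSize : ∀ {a ℓ p} {A : Set a} → Rel A ℓ → (A → Set p) → ℕ → Set (a ⊔ ℓ ⊔ p)
HasSize {A = A} _≈_ P k =
  Σ (Fin k → A) λ f →
    (∀ i → P (f i)) ×
    (∀ i j → f i ≈ f j → i ≡ j) ×
    (∀ x → P x → ∃ λ i → x ≈ f i)

-- Following the standard convention
-- (needed for the theorem to be true) the graph is
-- required to be neither edgeless nor complete.

IsSRG : ∀ {a ℓ r} {V : Set a} → Rel V ℓ → Rel V r → ℕ → ℕ → ℕ → ℕ → Set (a ⊔ ℓ ⊔ r)
IsSRG {V = V} _≈_ adj v k λ' μ =
  HasSize _≈_ (λ _ → ⊤ {ℓ = Level.zero}) v ×
  (∀ x → HasSize _≈_ (adj x) k) ×
  (∀ x y → adj x y → HasSize _≈_ (λ z → adj x z × adj y z) λ') ×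
  (∀ x y → ¬ (x ≈ y) → ¬ adj x y → HasSize _≈_ (λ z → adj x z × adj y z) μ) ×
  (∃ λ x → ∃ λ y → adj x y) ×
  (∃ λ x → ∃ λ y → ¬ (x ≈ y) × ¬ adj x y)

StronglyRegular : ∀ {a ℓ r} {V : Set a} → Rel V ℓ → Rel V r → Set (a ⊔ ℓ ⊔ r)
StronglyRegular _≈_ adj =
  ∃ λ v → ∃ λ k → ∃ λ λ' → ∃ λ μ → IsSRG _≈_ adj v k λ' μ

module Matrices {c ℓ} (F : FiniteField c ℓ) where
  open FiniteField F hiding (zero)

  Mat : ℕ → Set c
  Mat n = Fin n → Fin n → Carrier

  _≈M_ : ∀ {n} → Rel (Mat n) ℓ
  A ≈M B = ∀ i j → A i j ≈ B i j

  sumF : ∀ m → (Fin m → Carrier) → Carrier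
  sumF zero    f = 0#
  sumF (suc m) f = f zero + sumF m (λ i → f (suc i))

  _*M_ : ∀ {n} → Mat n → Mat n → Mat n
  _*M_ {n} A B i j = sumF n (λ l → A i l * B l j)

  _-M_ : ∀ {n} → Mat n → Mat n → Mat n
  (A -M B) i j = A i j - B i j

  I : ∀ {n} → Mat n
  I i j with i Fin.≟ j
  ... | yes _ = 1#
  ... | no  _ = 0#

  Invertible : ∀ {n} → Mat n → Set (c ⊔ ℓ)
  Invertible {n} A = ∃ λ (B : Mat n) → ((A *M B) ≈M I) × ((B *M A) ≈M I)

  UnitaryAdj : ∀ {n} → Rel (Mat n) (c ⊔ ℓ)
  UnitaryAdj A B = Invertible (A -M B)

  UnitaryCayleyGraphSRG : ℕ → Set (c ⊔ ℓ)
  UnitaryCayleyGraphSRG n = StronglyRegular (_≈M_ {n}) (UnitaryAdj {n})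

-- For n = 1 the graph is complete, and strong regularity requires a non-edge.
--
-- For n = 2, the maps z ↦ L z R + y with L, R invertible are automorphisms of the
-- graph.  They move any vertex to 0, any edge {x, y} (x - y invertible) to {I, 0},
-- and any non-edge (x - y of rank one, i.e. P (x - y) Q = E₀₀) to {E₀₀, 0}.  So the
-- degree and both common-neighbour counts are constants, obtained by filtering the
-- finite vertex set with the decidable test det ≠ 0.
--
-- For n ≥ 3, the non-edges {E₀₀, 0} and {E₀₀ + E₁₁, 0} have different numbers of
-- common neighbours.  For invertible Y with inverse W, Y - E₀₀ is invertible as soon
-- as W₀₀ ≠ 1 (Sherman–Morrison), while Y - (E₀₀ + E₁₁) invertible forces the leading
-- 2 × 2 block of I - W to be invertible.  Hence Y ↦ Y, or Y ↦ Y (I + W₀₁ E₀₁) when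
-- W₀₀ = 1, maps the common neighbours of the second pair injectively into those of
-- the first, and it misses I - (e₀ + e₂)(e₀ - e₂)ᵀ.

module Submission where

open import Defs
open import Data.Nat using (ℕ; _≤_)
open import Relation.Binary.PropositionalEquality using (_≡_)
open import Function.Bundles using (_⇔_)

open import Level using (0ℓ; _⊔_)
open import Data.Nat as ℕ using (zero; suc; _^_; _<_)
import Data.Nat.Properties as ℕₚ
open import Data.Fin as Fin using (Fin; zero; suc)
import Data.Fin.Properties as Finₚ
open import Data.Integer as ℤ using (ℤ; +_; -[1+_]; _⊖_)
import Data.Integer.Properties as ℤₚ
open import Data.Sign as Sign using (Sign)
open import Data.Maybe using (Maybe; just; nothing)
open import Data.Product using (Σ; ∃; ∃₂; _×_; _,_; proj₁; proj₂)
open import Data.Unit.Polymorphic using (⊤; tt)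
open import Data.Empty using (⊥-elim)
open import Data.Vec.Functional using (_∷_)
open import Data.Vec.Functional.Relation.Binary.Equality.Setoid using (≋-setoid)
open import Function using (_∘_)
open import Function.Bundles using (mk⇔)
open import Function.Definitions using (Injective)
open import Relation.Nullary using (¬_; yes; no; Dec)
open import Relation.Nullary.Decidable using (_×-dec_)
open import Relation.Unary using (Pred; Decidable; _⊆_)
open import Relation.Binary.Bundles using (Setoid)
open import Relation.Binary.Definitions using (_Respects_)
open import Relation.Binary.Structures using (IsEquivalence)
open import Relation.Binary.PropositionalEquality as ≡ using (_≢_; cong)
open import Algebra.Bundles using (CommutativeRing; RawRing)
import Algebra.Solver.Ring.AlmostCommutativeRing as ACR

-- The ring solver normalises coefficients with a decidable equality, which an
-- abstract ring lacks; we use integer coefficients via the canonical map ℤ → R.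
module IntegerCoefficients {c ℓ} (R : CommutativeRing c ℓ) where
  open CommutativeRing R
  open import Algebra.Properties.Ring ring using (-1*x≈-x)
  open import Algebra.Properties.AbelianGroup +-abelianGroup using (⁻¹-∙-comm)
  open import Algebra.Properties.Group +-group using (ε⁻¹≈ε; ⁻¹-involutive)
  open import Algebra.Properties.Semiring.Mult.TCOptimised semiring using (×-homo-+; ×1-homo-*; 1+×) renaming (_×_ to _·_)
  open import Relation.Binary.Reasoning.Setoid setoid

  ⟦_⟧ℤ : ℤ → Carrier
  ⟦ + n ⟧ℤ      = n · 1#
  ⟦ -[1+ n ] ⟧ℤ = - (suc n · 1#)

  ⟦⟧-neg : ∀ i → ⟦ ℤ.- i ⟧ℤ ≈ - ⟦ i ⟧ℤ
  ⟦⟧-neg (+ zero)  = sym ε⁻¹≈ε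
  ⟦⟧-neg (+ suc n) = refl
  ⟦⟧-neg -[1+ n ]  = sym (⁻¹-involutive _)

  ⟦⟧-⊖ : ∀ m n → ⟦ m ⊖ n ⟧ℤ ≈ m · 1# - n · 1#
  ⟦⟧-⊖ zero    zero    = sym (trans (+-congˡ ε⁻¹≈ε) (+-identityʳ _))
  ⟦⟧-⊖ zero    (suc n) = sym (+-identityˡ _)
  ⟦⟧-⊖ (suc m) zero    = sym (trans (+-congˡ ε⁻¹≈ε) (+-identityʳ _))
  ⟦⟧-⊖ (suc m) (suc n) = begin
    ⟦ suc m ⊖ suc n ⟧ℤ                    ≡⟨ cong ⟦_⟧ℤ (ℤₚ.[1+m]⊖[1+n]≡m⊖n m n) ⟩
    ⟦ m ⊖ n ⟧ℤ                            ≈⟨ ⟦⟧-⊖ m n ⟩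
    m · 1# - n · 1#                       ≈⟨ cancel (m · 1#) (n · 1#) ⟨
    (1# + m · 1#) - (1# + n · 1#)         ≈⟨ +-cong (sym (1+× m 1#)) (-‿cong (sym (1+× n 1#))) ⟩
    suc m · 1# - suc n · 1#               ∎
    where
    cancel : ∀ a b → (1# + a) - (1# + b) ≈ a - b
    cancel a b = begin
      (1# + a) - (1# + b)      ≈⟨ +-congˡ (⁻¹-∙-comm 1# b) ⟨
      (1# + a) + (- 1# + - b)  ≈⟨ +-congʳ (+-comm 1# a) ⟩
      (a + 1#) + (- 1# + - b)  ≈⟨ +-assoc a 1# _ ⟩
      a + (1# + (- 1# + - b))  ≈⟨ +-congˡ (+-assoc 1# (- 1#) (- b)) ⟨
      a + ((1# - 1#) + - b)    ≈⟨ +-congˡ (+-congʳ (-‿inverseʳ 1#)) ⟩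
      a + (0# + - b)           ≈⟨ +-congˡ (+-identityˡ (- b)) ⟩
      a - b                    ∎

  ⟦⟧-+ : ∀ i j → ⟦ i ℤ.+ j ⟧ℤ ≈ ⟦ i ⟧ℤ + ⟦ j ⟧ℤ
  ⟦⟧-+ -[1+ m ] -[1+ n ] = begin
    - (suc (suc (m ℕ.+ n)) · 1#)      ≡⟨ cong (λ k → - (k · 1#)) (ℕₚ.+-suc (suc m) n) ⟨
    - ((suc m ℕ.+ suc n) · 1#)        ≈⟨ -‿cong (×-homo-+ 1# (suc m) (suc n)) ⟩
    - (suc m · 1# + suc n · 1#)       ≈⟨ ⁻¹-∙-comm _ _ ⟨
    - (suc m · 1#) + - (suc n · 1#)   ∎
  ⟦⟧-+ -[1+ m ] (+ n)    = trans (⟦⟧-⊖ n (suc m)) (+-comm _ _)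
  ⟦⟧-+ (+ m)    -[1+ n ] = ⟦⟧-⊖ m (suc n)
  ⟦⟧-+ (+ m)    (+ n)    = ×-homo-+ 1# m n

  ⟦_⟧ₛ : Sign → Carrier
  ⟦ Sign.+ ⟧ₛ = 1#
  ⟦ Sign.- ⟧ₛ = - 1#

  ⟦⟧ₛ-* : ∀ s t → ⟦ s Sign.* t ⟧ₛ ≈ ⟦ s ⟧ₛ * ⟦ t ⟧ₛ
  ⟦⟧ₛ-* Sign.- Sign.- = sym (trans (-1*x≈-x (- 1#)) (⁻¹-involutive 1#))
  ⟦⟧ₛ-* Sign.- Sign.+ = sym (*-identityʳ _)
  ⟦⟧ₛ-* Sign.+ Sign.- = sym (*-identityˡ _)
  ⟦⟧ₛ-* Sign.+ Sign.+ = sym (*-identityˡ _)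

  ⟦⟧-◃ : ∀ s n → ⟦ s ℤ.◃ n ⟧ℤ ≈ ⟦ s ⟧ₛ * (n · 1#)
  ⟦⟧-◃ s      zero    = sym (zeroʳ _)
  ⟦⟧-◃ Sign.- (suc n) = sym (-1*x≈-x _)
  ⟦⟧-◃ Sign.+ (suc n) = sym (*-identityˡ _)

  ⟦⟧-sign-abs : ∀ i → ⟦ i ⟧ℤ ≈ ⟦ ℤ.sign i ⟧ₛ * (ℤ.∣ i ∣ · 1#)
  ⟦⟧-sign-abs i = trans (reflexive (cong ⟦_⟧ℤ (≡.sym (ℤₚ.◃-inverse i)))) (⟦⟧-◃ (ℤ.sign i) ℤ.∣ i ∣)

  ⟦⟧-* : ∀ i j → ⟦ i ℤ.* j ⟧ℤ ≈ ⟦ i ⟧ℤ * ⟦ j ⟧ℤ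
  ⟦⟧-* i j = begin
    ⟦ i ℤ.* j ⟧ℤ                                     ≈⟨ ⟦⟧-◃ (ℤ.sign i Sign.* ℤ.sign j) (∣i∣ ℕ.* ∣j∣) ⟩
    ⟦ ℤ.sign i Sign.* ℤ.sign j ⟧ₛ * ((∣i∣ ℕ.* ∣j∣) · 1#)
                                                     ≈⟨ *-cong (⟦⟧ₛ-* (ℤ.sign i) (ℤ.sign j)) (×1-homo-* ∣i∣ ∣j∣) ⟩
    (σ * τ) * (a * b)                                ≈⟨ middle-swap σ τ a b ⟩
    (σ * a) * (τ * b)                                ≈⟨ *-cong (⟦⟧-sign-abs i) (⟦⟧-sign-abs j) ⟨
    ⟦ i ⟧ℤ * ⟦ j ⟧ℤ                                  ∎
    where
    ∣i∣ = ℤ.∣ i ∣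
    ∣j∣ = ℤ.∣ j ∣
    σ = ⟦ ℤ.sign i ⟧ₛ
    τ = ⟦ ℤ.sign j ⟧ₛ
    a = ∣i∣ · 1#
    b = ∣j∣ · 1#
    middle-swap : ∀ w x y z → (w * x) * (y * z) ≈ (w * y) * (x * z)
    middle-swap w x y z = begin
      (w * x) * (y * z)  ≈⟨ *-assoc w x _ ⟩
      w * (x * (y * z))  ≈⟨ *-congˡ (*-assoc x y z) ⟨
      w * ((x * y) * z)  ≈⟨ *-congˡ (*-congʳ (*-comm x y)) ⟩
      w * ((y * x) * z)  ≈⟨ *-congˡ (*-assoc y x z) ⟩
      w * (y * (x * z))  ≈⟨ *-assoc w y _ ⟨
      (w * y) * (x * z)  ∎

  ℤ-rawRing : RawRing 0ℓ 0ℓ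
  ℤ-rawRing = record
    { Carrier = ℤ ; _≈_ = _≡_ ; _+_ = ℤ._+_ ; _*_ = ℤ._*_ ; -_ = ℤ.-_ ; 0# = + 0 ; 1# = + 1 }

  ℤ⟶R : ℤ-rawRing ACR.-Raw-AlmostCommutative⟶ ACR.fromCommutativeRing R
  ℤ⟶R = record
    { ⟦_⟧ = ⟦_⟧ℤ ; +-homo = ⟦⟧-+ ; *-homo = ⟦⟧-* ; -‿homo = ⟦⟧-neg ; 0-homo = refl ; 1-homo = refl }

  ⟦⟧-≟ : ∀ i j → Maybe (⟦ i ⟧ℤ ≈ ⟦ j ⟧ℤ)
  ⟦⟧-≟ i j with i ℤ.≟ j
  ... | yes ≡.refl = just refl
  ... | no _     = nothing

  open import Algebra.Solver.Ring ℤ-rawRing (ACR.fromCommutativeRing R) ℤ⟶R ⟦⟧-≟ public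

Fin-filter : ∀ {p N} {P : Pred (Fin N) p} → Decidable P → ∃ λ k → HasSize _≡_ P k
Fin-filter {N = zero}  P? = zero , (λ ()) , (λ ()) , (λ ()) , λ ()
Fin-filter {N = suc N} {P} P? with Fin-filter (P? ∘ suc) | P? zero
... | k , h , h∈ , h-inj , h-onto | no ¬P0 =
  k , suc ∘ h , h∈ , (λ i j eq → h-inj i j (Finₚ.suc-injective eq)) , onto
  where
  onto : ∀ j → P j → ∃ λ i → j ≡ suc (h i)
  onto zero    P0 = ⊥-elim (¬P0 P0)
  onto (suc j) Pj = let i , eq = h-onto j Pj in i , cong suc eq
... | k , h , h∈ , h-inj , h-onto | yes P0 =
  suc k , zero ∷ suc ∘ h , included , inj , onto
  where
  included : ∀ i → P ((zero ∷ suc ∘ h) i)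
  included zero    = P0
  included (suc i) = h∈ i
  inj : ∀ i j → (zero ∷ suc ∘ h) i ≡ (zero ∷ suc ∘ h) j → i ≡ j
  inj zero    zero    _  = ≡.refl
  inj zero    (suc j) ()
  inj (suc i) zero    ()
  inj (suc i) (suc j) eq = cong suc (h-inj i j (Finₚ.suc-injective eq))
  onto : ∀ j → P j → ∃ λ i → j ≡ (zero ∷ suc ∘ h) i
  onto zero    _  = zero , ≡.refl
  onto (suc j) Pj = let i , eq = h-onto j Pj in suc i , cong suc eq

module Counting {a ℓ} (S : Setoid a ℓ) where
  open Setoid S renaming (Carrier to A)

  Cardinality : ℕ → Set (a ⊔ ℓ)
  Cardinality N = HasSize _≈_ (λ _ → ⊤ {ℓ = 0ℓ}) N

  HasSize-bijection : ∀ {p q} {P : Pred A p} {Q : Pred A q} {k} (φ ψ : A → A) →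
    (∀ {x} → P x → Q (φ x)) → (∀ {y} → Q y → P (ψ y)) →
    (∀ {x y} → x ≈ y → φ x ≈ φ y) → (∀ {x y} → x ≈ y → ψ x ≈ ψ y) →
    (∀ x → ψ (φ x) ≈ x) → (∀ y → φ (ψ y) ≈ y) →
    HasSize _≈_ P k → HasSize _≈_ Q k
  HasSize-bijection φ ψ φ∈ ψ∈ φ-cong ψ-cong ψφ φψ (g , g∈ , g-inj , g-onto) =
    φ ∘ g , φ∈ ∘ g∈ ,
    (λ i j eq → g-inj i j (trans (sym (ψφ (g i))) (trans (ψ-cong eq) (ψφ (g j))))) ,
    λ y Qy → let i , eq = g-onto (ψ y) (ψ∈ Qy) in i , trans (sym (φψ y)) (φ-cong eq)

  HasSize-⇔ : ∀ {p q} {P : Pred A p} {Q : Pred A q} {k} → P ⊆ Q → Q ⊆ P →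
    HasSize _≈_ P k → HasSize _≈_ Q k
  HasSize-⇔ P⊆Q Q⊆P (g , g∈ , g-inj , g-onto) = g , P⊆Q ∘ g∈ , g-inj , λ y Qy → g-onto y (Q⊆P Qy)

  HasSize-filter : ∀ {p} {P : Pred A p} {N} → Cardinality N → Decidable P → P Respects _≈_ →
    ∃ λ k → HasSize _≈_ P k
  HasSize-filter {P = P} (g , _ , g-inj , g-onto) P? P-resp with Fin-filter (P? ∘ g)
  ... | k , h , h∈ , h-inj , h-onto =
    k , g ∘ h , h∈ , (λ i j eq → h-inj i j (g-inj _ _ eq)) , onto
    where
    onto : ∀ x → P x → ∃ λ i → x ≈ g (h i)
    onto x Px with g-onto x tt
    ... | j , x≈gj with h-onto j (P-resp x≈gj Px)
    ...   | i , ≡.refl = i , x≈gj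

  HasSize-injective⇒≤ : ∀ {p} {P : Pred A p} {k m} → HasSize _≈_ P k →
    (h : Fin m → A) → (∀ i → P (h i)) → (∀ i j → h i ≈ h j → i ≡ j) → m ≤ k
  HasSize-injective⇒≤ {P = P} {k} {m} (g , _ , _ , g-onto) h h∈ h-inj = Finₚ.injective⇒≤ index-injective
    where
    index : Fin m → Fin k
    index i = proj₁ (g-onto (h i) (h∈ i))
    index-injective : Injective _≡_ _≡_ index
    index-injective {i} {j} eq =
      h-inj i j (trans (proj₂ (g-onto _ _)) (trans (reflexive (cong g eq)) (sym (proj₂ (g-onto _ _)))))

  HasSize-injection-missing⇒< : ∀ {p q} {P : Pred A p} {Q : Pred A q} {k k′} →
    HasSize _≈_ P k → HasSize _≈_ Q k′ →
    (f : ∀ y → Q y → A) → (∀ y Qy → P (f y Qy)) →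
    (∀ y Qy y′ Qy′ → f y Qy ≈ f y′ Qy′ → y ≈ y′) →
    (e : A) → P e → (∀ y Qy → ¬ f y Qy ≈ e) → k′ < k
  HasSize-injection-missing⇒< {P = P} {k′ = k′} sizeP (g , g∈ , g-inj , _) f f∈ f-inj e e∈ miss =
    HasSize-injective⇒≤ sizeP h h∈ h-inj
    where
    h : Fin (suc k′) → A
    h = e ∷ λ i → f (g i) (g∈ i)
    h∈ : ∀ i → P (h i)
    h∈ zero    = e∈
    h∈ (suc i) = f∈ (g i) (g∈ i)
    h-inj : ∀ i j → h i ≈ h j → i ≡ j
    h-inj zero    zero    _  = ≡.refl
    h-inj zero    (suc j) eq = ⊥-elim (miss _ _ (sym eq))
    h-inj (suc i) zero    eq = ⊥-elim (miss _ _ eq)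
    h-inj (suc i) (suc j) eq = cong suc (g-inj i j (f-inj _ _ _ _ eq))

Cardinality-Vector : ∀ {a ℓ} (S : Setoid a ℓ) {N} → Counting.Cardinality S N →
  ∀ k → Counting.Cardinality (≋-setoid S k) (N ^ k)
Cardinality-Vector S card zero = (λ _ ()) , _ , (λ { zero zero _ → ≡.refl }) , λ _ _ → zero , λ ()
Cardinality-Vector S {N} card@(g , _ , g-inj , g-onto) (suc k)
  with Cardinality-Vector S card k
... | vs , _ , vs-inj , vs-onto = vector ∘ Fin.remQuot (N ^ k) , _ , inj , onto
  where
  open Setoid S
  vector : Fin N × Fin (N ^ k) → Fin (suc k) → Carrier
  vector (i , j) = g i ∷ vs j
  inj : ∀ x y → (∀ l → vector (Fin.remQuot (N ^ k) x) l ≈ vector (Fin.remQuot (N ^ k) y) l) → x ≡ y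
  inj x y eq = ≡.trans (≡.sym (Finₚ.combine-remQuot {N} (N ^ k) x))
    (≡.trans (≡.cong₂ Fin.combine (g-inj _ _ (eq zero)) (vs-inj _ _ (eq ∘ suc)))
             (Finₚ.combine-remQuot {N} (N ^ k) y))
  onto : ∀ v → ⊤ {ℓ = 0ℓ} → ∃ λ x → ∀ l → v l ≈ vector (Fin.remQuot (N ^ k) x) l
  onto v _ with g-onto (v zero) tt | vs-onto (v ∘ suc) tt
  ... | i , v₀≈ | j , vₛ≈ = Fin.combine i j ,
    ≡.subst (λ ij → ∀ l → v l ≈ vector ij l) (≡.sym (Finₚ.remQuot-combine i j)) λ { zero → v₀≈ ; (suc l) → vₛ≈ l }

module MatrixAlgebra {c ℓ} (F : FiniteField c ℓ) where
  open FiniteField F hiding (zero)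
  open Matrices F
  open IntegerCoefficients commutativeRing public using (solve; _:=_; _:+_; _:-_; _:*_; :-_; con; Polynomial)
  open import Algebra.Properties.Group +-group using (ε⁻¹≈ε; x∙y⁻¹≈ε⇒x≈y) renaming (⁻¹-involutive to -‿involutive)
  open import Algebra.Properties.Semiring.Sum semiring
    using (sum; sum-cong-≋; sum-replicate-zero; ∑-distrib-+; ∑-comm; *-distribˡ-sum; *-distribʳ-sum)
  open import Algebra.Properties.Ring ring using (-1*x≈-x; x[y-z]≈xy-xz; [y-z]x≈yx-zx)
  open import Relation.Binary.Reasoning.Setoid setoid

  :0 :1 : ∀ {k} → Polynomial k
  :0 = con (+ 0)
  :1 = con (+ 1)

  1≉0 : ¬ 1# ≈ 0#
  1≉0 = 0≉1 ∘ sym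

  -0≈0 : - 0# ≈ 0#
  -0≈0 = ε⁻¹≈ε

  -x≈0⇒x≈0 : ∀ {x} → - x ≈ 0# → x ≈ 0#
  -x≈0⇒x≈0 {x} -x≈0 = trans (sym (-‿involutive x)) (trans (-‿cong -x≈0) -0≈0)

  -x*-y≈x*y : ∀ x y → (- x) * (- y) ≈ x * y
  -x*-y≈x*y = solve 2 (λ x y → (:- x) :* (:- y) := x :* y) refl

  x-y+y≈x : ∀ x y → (x - y) + y ≈ x
  x-y+y≈x = solve 2 (λ x y → (x :- y) :+ y := x) refl

  x+y-y≈x : ∀ x y → (x + y) - y ≈ x
  x+y-y≈x = solve 2 (λ x y → (x :+ y) :- y := x) refl

  x-y≈0⇒x≈y : ∀ {x y} → x - y ≈ 0# → x ≈ y
  x-y≈0⇒x≈y = x∙y⁻¹≈ε⇒x≈y _ _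

  module _ {x : Carrier} (x≉0 : ¬ x ≈ 0#) where
    x⁻¹ : Carrier
    x⁻¹ = proj₁ (inverse x x≉0)

    x*x⁻¹≈1 : x * x⁻¹ ≈ 1#
    x*x⁻¹≈1 = proj₂ (inverse x x≉0)

    *-cancelʳ : ∀ {y z} → y * x ≈ z * x → y ≈ z
    *-cancelʳ {y} {z} eq = begin
      y               ≈⟨ *-identityʳ y ⟨
      y * 1#          ≈⟨ *-congˡ x*x⁻¹≈1 ⟨
      y * (x * x⁻¹)   ≈⟨ *-assoc y x x⁻¹ ⟨
      (y * x) * x⁻¹   ≈⟨ *-congʳ eq ⟩
      (z * x) * x⁻¹   ≈⟨ *-assoc z x x⁻¹ ⟩
      z * (x * x⁻¹)   ≈⟨ *-congˡ x*x⁻¹≈1 ⟩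
      z * 1#          ≈⟨ *-identityʳ z ⟩
      z               ∎

  singular₂⇒kernel : ∀ a b c d → a * d - b * c ≈ 0# →
    ∃₂ λ x y → ¬ (x ≈ 0# × y ≈ 0#) × a * x + b * y ≈ 0# × c * x + d * y ≈ 0#
  singular₂⇒kernel a b c d det≈0 with (a ≟ 0#) ×-dec (b ≟ 0#)
  ... | no ¬a,b≈0 = b , - a , (λ (b≈0 , -a≈0) → ¬a,b≈0 (-x≈0⇒x≈0 -a≈0 , b≈0)) ,
        solve 2 (λ a b → a :* b :+ b :* :- a := :0) refl a b ,
        trans (solve 4 (λ a b c d → c :* b :+ d :* :- a := :- (a :* d :- b :* c)) refl a b c d) (trans (-‿cong det≈0) -0≈0)
  ... | yes (a≈0 , b≈0) with (c ≟ 0#) ×-dec (d ≟ 0#)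
  ...   | no ¬c,d≈0 = d , - c , (λ (d≈0 , -c≈0) → ¬c,d≈0 (-x≈0⇒x≈0 -c≈0 , d≈0)) ,
          trans (solve 4 (λ a b c d → a :* d :+ b :* :- c := a :* d :- b :* c) refl a b c d) det≈0 ,
          solve 2 (λ c d → c :* d :+ d :* :- c := :0) refl c d
  ...   | yes (c≈0 , d≈0) = 1# , 0# , 1≉0 ∘ proj₁ , zero-row a≈0 b≈0 , zero-row c≈0 d≈0
    where
    zero-row : ∀ {x y} → x ≈ 0# → y ≈ 0# → x * 1# + y * 0# ≈ 0#
    zero-row x≈0 y≈0 = trans (+-cong (trans (*-identityʳ _) x≈0) (zeroʳ _)) (+-identityʳ 0#)

  sumF≈sum : ∀ m (f : Fin m → Carrier) → sumF m f ≈ sum f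
  sumF≈sum zero    f = refl
  sumF≈sum (suc m) f = +-congˡ (sumF≈sum m (f ∘ suc))

  module _ (m : ℕ) where
    sumF-cong : ∀ {f g : Fin m → Carrier} → (∀ i → f i ≈ g i) → sumF m f ≈ sumF m g
    sumF-cong {f} {g} f≈g = trans (sumF≈sum m f) (trans (sum-cong-≋ f≈g) (sym (sumF≈sum m g)))

    sumF-zero : sumF m (λ _ → 0#) ≈ 0#
    sumF-zero = trans (sumF≈sum m _) (sum-replicate-zero m)

    sumF-+ : ∀ (f g : Fin m → Carrier) → sumF m (λ i → f i + g i) ≈ sumF m f + sumF m g
    sumF-+ f g = trans (sumF≈sum m _)
      (trans (∑-distrib-+ f g) (sym (+-cong (sumF≈sum m f) (sumF≈sum m g))))

    sumF-*ˡ : ∀ x (f : Fin m → Carrier) → sumF m (λ i → x * f i) ≈ x * sumF m f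
    sumF-*ˡ x f = trans (sumF≈sum m _) (trans (sym (*-distribˡ-sum x f)) (*-congˡ (sym (sumF≈sum m f))))

    sumF-*ʳ : ∀ x (f : Fin m → Carrier) → sumF m (λ i → f i * x) ≈ sumF m f * x
    sumF-*ʳ x f = trans (sumF≈sum m _) (trans (sym (*-distribʳ-sum x f)) (*-congʳ (sym (sumF≈sum m f))))

    sumF-neg : ∀ (f : Fin m → Carrier) → sumF m (λ i → - f i) ≈ - sumF m f
    sumF-neg f = begin
      sumF m (λ i → - f i)       ≈⟨ sumF-cong (λ i → -1*x≈-x (f i)) ⟨
      sumF m (λ i → - 1# * f i)  ≈⟨ sumF-*ˡ (- 1#) f ⟩
      - 1# * sumF m f            ≈⟨ -1*x≈-x _ ⟩
      - sumF m f                 ∎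

    sumF-- : ∀ (f g : Fin m → Carrier) → sumF m (λ i → f i - g i) ≈ sumF m f - sumF m g
    sumF-- f g = trans (sumF-+ f (λ i → - g i)) (+-congˡ (sumF-neg g))

  sumF-comm : ∀ m k (f : Fin m → Fin k → Carrier) →
    sumF m (λ i → sumF k (f i)) ≈ sumF k (λ j → sumF m (λ i → f i j))
  sumF-comm m k f = begin
    sumF m (λ i → sumF k (f i))          ≈⟨ sumF-cong m (λ i → sumF≈sum k (f i)) ⟩
    sumF m (λ i → sum (f i))             ≈⟨ sumF≈sum m _ ⟩
    sum (λ i → sum (f i))                ≈⟨ ∑-comm f ⟩
    sum (λ j → sum (λ i → f i j))        ≈⟨ sumF≈sum k _ ⟨
    sumF k (λ j → sum (λ i → f i j))     ≈⟨ sumF-cong k (λ j → sumF≈sum m (λ i → f i j)) ⟨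
    sumF k (λ j → sumF m (λ i → f i j))  ∎

  δ : ∀ {n} → Fin n → Fin n → Carrier
  δ zero    zero    = 1#
  δ zero    (suc j) = 0#
  δ (suc i) zero    = 0#
  δ (suc i) (suc j) = δ i j

  δ-sym : ∀ {n} (i j : Fin n) → δ i j ≡ δ j i
  δ-sym zero    zero    = ≡.refl
  δ-sym zero    (suc j) = ≡.refl
  δ-sym (suc i) zero    = ≡.refl
  δ-sym (suc i) (suc j) = δ-sym i j

  δ-diagonal : ∀ {n} (i : Fin n) → δ i i ≡ 1#
  δ-diagonal zero    = ≡.refl
  δ-diagonal (suc i) = δ-diagonal i

  δ-offDiagonal : ∀ {n} {i j : Fin n} → i ≢ j → δ i j ≡ 0#
  δ-offDiagonal {i = zero}  {zero}  i≢j = ⊥-elim (i≢j ≡.refl)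
  δ-offDiagonal {i = zero}  {suc j} i≢j = ≡.refl
  δ-offDiagonal {i = suc i} {zero}  i≢j = ≡.refl
  δ-offDiagonal {i = suc i} {suc j} i≢j = δ-offDiagonal (i≢j ∘ cong suc)

  I≈δ : ∀ {n} (i j : Fin n) → I i j ≈ δ i j
  I≈δ i j with i Fin.≟ j
  ... | yes ≡.refl = reflexive (≡.sym (δ-diagonal i))
  ... | no i≢j     = reflexive (≡.sym (δ-offDiagonal i≢j))

  ≈δ⇒≈I : ∀ {n} {X : Mat n} → (∀ i j → X i j ≈ δ i j) → X ≈M I
  ≈δ⇒≈I X≈δ i j = trans (X≈δ i j) (sym (I≈δ i j))

  sumF-δˡ : ∀ {m} (k : Fin m) (f : Fin m → Carrier) → sumF m (λ l → δ k l * f l) ≈ f k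
  sumF-δˡ {suc m} zero f = begin
    1# * f zero + sumF m (λ l → 0# * f (suc l))  ≈⟨ +-cong (*-identityˡ _) (sumF-cong m (λ l → zeroˡ _)) ⟩
    f zero + sumF m (λ _ → 0#)                   ≈⟨ +-congˡ (sumF-zero m) ⟩
    f zero + 0#                                  ≈⟨ +-identityʳ _ ⟩
    f zero                                       ∎
  sumF-δˡ {suc m} (suc k) f = trans (+-cong (zeroˡ _) (sumF-δˡ k (f ∘ suc))) (+-identityˡ _)

  sumF-δʳ : ∀ {m} (k : Fin m) (f : Fin m → Carrier) → sumF m (λ l → f l * δ l k) ≈ f k
  sumF-δʳ {m} k f = trans (sumF-cong m (λ l → trans (*-comm _ _) (*-congʳ (reflexive (δ-sym l k))))) (sumF-δˡ k f)

  ≈M-isEquivalence : ∀ {n} → IsEquivalence (_≈M_ {n})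
  ≈M-isEquivalence = record
    { refl = λ _ _ → refl ; sym = λ A≈B i j → sym (A≈B i j) ; trans = λ A≈B B≈C i j → trans (A≈B i j) (B≈C i j) }

  Mat-setoid : ℕ → Setoid c ℓ
  Mat-setoid n = record { isEquivalence = ≈M-isEquivalence {n} }

  module _ {n : ℕ} where
    open IsEquivalence (≈M-isEquivalence {n}) public
      using () renaming (refl to ≈M-refl; sym to ≈M-sym; trans to ≈M-trans)

  0M : ∀ {n} → Mat n
  0M _ _ = 0#

  _+M_ : ∀ {n} → Mat n → Mat n → Mat n
  (A +M B) i j = A i j + B i j

  column : ∀ {n} → Mat n → Fin n → Fin n → Carrier
  column A j i = A i j

  _·_ : ∀ {n} → (Fin n → Carrier) → (Fin n → Carrier) → Carrier
  _·_ {n} u v = sumF n (λ l → u l * v l)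

  ·-comm : ∀ {n} (u v : Fin n → Carrier) → u · v ≈ v · u
  ·-comm {n} u v = sumF-cong n (λ l → *-comm (u l) (v l))

  *M-cong : ∀ {n} {A A′ B B′ : Mat n} → A ≈M A′ → B ≈M B′ → (A *M B) ≈M (A′ *M B′)
  *M-cong {n} A≈A′ B≈B′ i j = sumF-cong n (λ l → *-cong (A≈A′ i l) (B≈B′ l j))

  _*v_ : ∀ {n} → Mat n → (Fin n → Carrier) → Fin n → Carrier
  (A *v x) i = A i · x

  *v-assoc : ∀ {n} (A B : Mat n) (x : Fin n → Carrier) i → ((A *M B) *v x) i ≈ (A *v (B *v x)) i
  *v-assoc {n} A B x i = begin
    sumF n (λ l → sumF n (λ k → A i k * B k l) * x l)    ≈⟨ sumF-cong n (λ l → sumF-*ʳ n (x l) _) ⟨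
    sumF n (λ l → sumF n (λ k → (A i k * B k l) * x l))  ≈⟨ sumF-comm n n _ ⟩
    sumF n (λ k → sumF n (λ l → (A i k * B k l) * x l))  ≈⟨ sumF-cong n (λ k → sumF-cong n (λ l → *-assoc _ _ _)) ⟩
    sumF n (λ k → sumF n (λ l → A i k * (B k l * x l)))  ≈⟨ sumF-cong n (λ k → sumF-*ˡ n (A i k) _) ⟩
    sumF n (λ k → A i k * sumF n (λ l → B k l * x l))    ∎

  *v-cong : ∀ {n} (A : Mat n) {x y : Fin n → Carrier} → (∀ i → x i ≈ y i) → ∀ i → (A *v x) i ≈ (A *v y) i
  *v-cong {n} A x≈y i = sumF-cong n (λ l → *-congˡ (x≈y l))

  *v-congˡ : ∀ {n} {A B : Mat n} → A ≈M B → (x : Fin n → Carrier) → ∀ i → (A *v x) i ≈ (B *v x) i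
  *v-congˡ {n} A≈B x i = sumF-cong n (λ l → *-congʳ (A≈B i l))

  -M-*v : ∀ {n} (A B : Mat n) (x : Fin n → Carrier) i → ((A -M B) *v x) i ≈ (A *v x) i - (B *v x) i
  -M-*v {n} A B x i = trans (sumF-cong n (λ l → [y-z]x≈yx-zx (x l) (A i l) (B i l))) (sumF-- n _ _)

  I*v : ∀ {n} (x : Fin n → Carrier) i → (I *v x) i ≈ x i
  I*v {n} x i = trans (sumF-cong n (λ l → *-congʳ (I≈δ i l))) (sumF-δˡ i x)

  *v-inverseʳ : ∀ {n} {Y W : Mat n} → (Y *M W) ≈M I → ∀ x i → (Y *v (W *v x)) i ≈ x i
  *v-inverseʳ {Y = Y} {W} YW≈I x i = begin
    (Y *v (W *v x)) i  ≈⟨ *v-assoc Y W x i ⟨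
    ((Y *M W) *v x) i  ≈⟨ *v-congˡ YW≈I x i ⟩
    (I *v x) i         ≈⟨ I*v x i ⟩
    x i                ∎

  *M-assoc : ∀ {n} (A B C : Mat n) → ((A *M B) *M C) ≈M (A *M (B *M C))
  *M-assoc A B C i j = *v-assoc A B (column C j) i

  *M-identityˡ : ∀ {n} (A : Mat n) → (I *M A) ≈M A
  *M-identityˡ A i j = I*v (column A j) i

  *M-identityʳ : ∀ {n} (A : Mat n) → (A *M I) ≈M A
  *M-identityʳ {n} A i j = trans (sumF-cong n (λ l → *-congˡ (I≈δ l j))) (sumF-δʳ j (A i))

  *M-zeroʳ : ∀ {n} (A : Mat n) → (A *M 0M) ≈M 0M
  *M-zeroʳ {n} A i j = trans (sumF-cong n (λ l → zeroʳ (A i l))) (sumF-zero n)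

  *M-zeroˡ : ∀ {n} (A : Mat n) → (0M *M A) ≈M 0M
  *M-zeroˡ {n} A i j = trans (sumF-cong n (λ l → zeroˡ (A l j))) (sumF-zero n)

  *M-distribˡ-M : ∀ {n} (L A B : Mat n) → (L *M (A -M B)) ≈M ((L *M A) -M (L *M B))
  *M-distribˡ-M {n} L A B i j =
    trans (sumF-cong n (λ l → x[y-z]≈xy-xz (L i l) (A l j) (B l j))) (sumF-- n _ _)

  *M-distribʳ-M : ∀ {n} (A B R : Mat n) → ((A -M B) *M R) ≈M ((A *M R) -M (B *M R))
  *M-distribʳ-M {n} A B R i j =
    -M-*v A B (column R j) i

  Invertible-cong : ∀ {n} {A A′ : Mat n} → A ≈M A′ → Invertible A → Invertible A′
  Invertible-cong A≈A′ (B , AB≈I , BA≈I) =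
    B , ≈M-trans (*M-cong (≈M-sym A≈A′) ≈M-refl) AB≈I , ≈M-trans (*M-cong ≈M-refl (≈M-sym A≈A′)) BA≈I

  Invertible-I : ∀ {n} → Invertible (I {n})
  Invertible-I = I , *M-identityˡ I , *M-identityˡ I

  inverse-unique : ∀ {n} {A B C : Mat n} → (A *M B) ≈M I → (C *M A) ≈M I → B ≈M C
  inverse-unique {A = A} {B} {C} AB≈I CA≈I =
    ≈M-trans (≈M-sym (*M-identityˡ B)) (≈M-trans (*M-cong (≈M-sym CA≈I) ≈M-refl)
      (≈M-trans (*M-assoc C A B) (≈M-trans (*M-cong ≈M-refl AB≈I) (*M-identityʳ C))))

  inverse-of-* : ∀ {n} {A A′ B B′ : Mat n} → (A *M A′) ≈M I → (B *M B′) ≈M I →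
    ((A *M B) *M (B′ *M A′)) ≈M I
  inverse-of-* {A = A} {A′} {B} {B′} AA′≈I BB′≈I =
    ≈M-trans (*M-assoc A B _) (≈M-trans (*M-cong ≈M-refl (≈M-sym (*M-assoc B B′ A′)))
      (≈M-trans (*M-cong ≈M-refl (*M-cong BB′≈I ≈M-refl)) (≈M-trans (*M-cong ≈M-refl (*M-identityˡ A′)) AA′≈I)))

  Invertible-* : ∀ {n} {A B : Mat n} → Invertible A → Invertible B → Invertible (A *M B)
  Invertible-* (A′ , AA′≈I , A′A≈I) (B′ , BB′≈I , B′B≈I) =
    B′ *M A′ , inverse-of-* AA′≈I BB′≈I , inverse-of-* B′B≈I A′A≈I

  Invertible-neg : ∀ {n} {A A′ : Mat n} → (∀ i j → A′ i j ≈ - A i j) → Invertible A → Invertible A′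
  Invertible-neg {n} {A} A′≈-A (B , AB≈I , BA≈I) = Invertible-cong (λ i j → sym (A′≈-A i j))
    (-B , ≈M-trans (λ i j → sumF-cong n (λ l → -x*-y≈x*y _ _)) AB≈I ,
          ≈M-trans (λ i j → sumF-cong n (λ l → -x*-y≈x*y _ _)) BA≈I)
    where
    -B : Mat n
    -B i j = - B i j

  Invertible-kernel : ∀ {n} {M : Mat n} → Invertible M → (x : Fin n → Carrier) →
    (∀ i → (M *v x) i ≈ 0#) → ∀ i → x i ≈ 0#
  Invertible-kernel {n} {M} (M⁻¹ , _ , M⁻¹M≈I) x Mx≈0 i = begin
    x i                        ≈⟨ I*v x i ⟨
    (I *v x) i                 ≈⟨ *v-congˡ M⁻¹M≈I x i ⟨
    ((M⁻¹ *M M) *v x) i        ≈⟨ *v-assoc M⁻¹ M x i ⟩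
    (M⁻¹ *v (M *v x)) i        ≈⟨ *v-cong M⁻¹ Mx≈0 i ⟩
    (M⁻¹ *v (λ _ → 0#)) i      ≈⟨ *M-zeroʳ M⁻¹ i i ⟩
    0#                         ∎

  zero-column⇒¬Invertible : ∀ {n} {M : Mat n} (k : Fin n) → (∀ i → M i k ≈ 0#) → ¬ Invertible M
  zero-column⇒¬Invertible {n} {M} k Mk≈0 M-inv = 1≉0 (begin
    1#      ≡⟨ δ-diagonal k ⟨
    δ k k   ≈⟨ Invertible-kernel M-inv (δ k) Mδₖ≈0 k ⟩
    0#      ∎)
    where
    Mδₖ≈0 : ∀ i → (M *v δ k) i ≈ 0#
    Mδₖ≈0 i = trans (sumF-cong n (λ l → *-congˡ (reflexive (δ-sym k l)))) (trans (sumF-δʳ k (M i)) (Mk≈0 i))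

  elementary : ∀ {n} → Carrier → (Fin n → Carrier) → (Fin n → Carrier) → Mat n
  elementary a u v i j = δ i j + a * (u i * v j)

  elementary-*v : ∀ {n} a (u v x : Fin n → Carrier) i →
    (elementary a u v *v x) i ≈ x i + a * (u i * (v · x))
  elementary-*v {n} a u v x i = begin
    sumF n (λ l → (δ i l + a * (u i * v l)) * x l)                       ≈⟨ sumF-cong n (λ l → expand (δ i l) a (u i) (v l) (x l)) ⟩
    sumF n (λ l → δ i l * x l + (a * u i) * (v l * x l))                  ≈⟨ sumF-+ n _ _ ⟩
    sumF n (λ l → δ i l * x l) + sumF n (λ l → (a * u i) * (v l * x l))  ≈⟨ +-cong (sumF-δˡ i x) (sumF-*ˡ n (a * u i) _) ⟩
    x i + (a * u i) * (v · x)                                             ≈⟨ +-congˡ (*-assoc a (u i) _) ⟩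
    x i + a * (u i * (v · x))                                             ∎
    where
    expand : ∀ d a u v x → (d + a * (u * v)) * x ≈ d * x + (a * u) * (v * x)
    expand = solve 5 (λ d a u v x → (d :+ a :* (u :* v)) :* x := d :* x :+ (a :* u) :* (v :* x)) refl

  ·-elementary : ∀ {n} a (u v x : Fin n → Carrier) j →
    x · column (elementary a u v) j ≈ x j + a * ((x · u) * v j)
  ·-elementary {n} a u v x j = begin
    sumF n (λ l → x l * (δ l j + a * (u l * v j)))                       ≈⟨ sumF-cong n (λ l → expand (x l) (δ l j) a (u l) (v j)) ⟩
    sumF n (λ l → x l * δ l j + (x l * u l) * (a * v j))                  ≈⟨ sumF-+ n _ _ ⟩
    sumF n (λ l → x l * δ l j) + sumF n (λ l → (x l * u l) * (a * v j))  ≈⟨ +-cong (sumF-δʳ j x) (sumF-*ʳ n (a * v j) _) ⟩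
    x j + (x · u) * (a * v j)                                             ≈⟨ +-congˡ (swap (x · u) a (v j)) ⟩
    x j + a * ((x · u) * v j)                                             ∎
    where
    expand : ∀ x d a u v → x * (d + a * (u * v)) ≈ x * d + (x * u) * (a * v)
    expand = solve 5 (λ x d a u v → x :* (d :+ a :* (u :* v)) := x :* d :+ (x :* u) :* (a :* v)) refl
    swap : ∀ z a v → z * (a * v) ≈ a * (z * v)
    swap = solve 3 (λ z a v → z :* (a :* v) := a :* (z :* v)) refl

  -- (I + a u vᵀ)(I + b u vᵀ) = I + (a + b + a b (v · u)) u vᵀ.
  elementary-*M-elementary : ∀ {n} {a b} {u v : Fin n → Carrier} → a + b + a * b * (v · u) ≈ 0# →
    (elementary a u v *M elementary b u v) ≈M I
  elementary-*M-elementary {n} {a} {b} {u} {v} a+b+abvu≈0 i j = begin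
    (elementary a u v *v column (elementary b u v) j) i                ≈⟨ elementary-*v a u v _ i ⟩
    (δ i j + b * (u i * v j)) + a * (u i * (v · column (elementary b u v) j))
                                                                      ≈⟨ +-congˡ (*-congˡ (*-congˡ (·-elementary b u v v j))) ⟩
    (δ i j + b * (u i * v j)) + a * (u i * (v j + b * ((v · u) * v j)))  ≈⟨ collect (δ i j) a b (u i) (v j) (v · u) ⟩
    δ i j + (a + b + a * b * (v · u)) * (u i * v j)                   ≈⟨ +-congˡ (trans (*-congʳ a+b+abvu≈0) (zeroˡ _)) ⟩
    δ i j + 0#                                                        ≈⟨ +-identityʳ _ ⟩
    δ i j                                                             ≈⟨ I≈δ i j ⟨
    I i j                                                             ∎
    where
    collect : ∀ d a b x y c → (d + b * (x * y)) + a * (x * (y + b * (c * y))) ≈ d + (a + b + a * b * c) * (x * y)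
    collect = solve 6 (λ d a b x y c →
      (d :+ b :* (x :* y)) :+ a :* (x :* (y :+ b :* (c :* y))) := d :+ (a :+ b :+ a :* b :* c) :* (x :* y)) refl

  elementary-inverse : ∀ {n} {a b} {u v : Fin n → Carrier} → a + b + a * b * (v · u) ≈ 0# →
    (elementary a u v *M elementary b u v) ≈M I × (elementary b u v *M elementary a u v) ≈M I
  elementary-inverse {a = a} {b} {u} {v} a+b+abvu≈0 =
    elementary-*M-elementary a+b+abvu≈0 , elementary-*M-elementary (trans (symmetric a b (v · u)) a+b+abvu≈0)
    where
    symmetric : ∀ a b c → b + a + b * a * c ≈ a + b + a * b * c
    symmetric = solve 3 (λ a b c → b :+ a :+ b :* a :* c := a :+ b :+ a :* b :* c) refl

  E₀₀ : ∀ {m} → Mat (suc m)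
  E₀₀ i j = δ zero i * δ zero j

  -- Sherman–Morrison: Y - E₀₀ = Y (I - (W e₀) e₀ᵀ), and the second factor has
  -- inverse I + s (W e₀) e₀ᵀ with s = (1 - W₀₀)⁻¹.
  Invertible-minus-E₀₀ : ∀ {m} {Y W : Mat (suc m)} → (Y *M W) ≈M I → (W *M Y) ≈M I →
    ¬ W zero zero ≈ 1# → Invertible (Y -M E₀₀)
  Invertible-minus-E₀₀ {m} {Y} {W} YW≈I WY≈I W₀₀≉1 =
    Invertible-cong YR≈Y-E₀₀ (Invertible-* {A = Y} {B = R} (W , YW≈I , WY≈I) (R′ , elementary-inverse condition))
    where
    w = W zero zero
    1-w≉0 : ¬ 1# - w ≈ 0#
    1-w≉0 = W₀₀≉1 ∘ sym ∘ x-y≈0⇒x≈y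
    s = x⁻¹ 1-w≉0
    R R′ : Mat (suc m)
    R  = elementary (- 1#) (column W zero) (δ zero)
    R′ = elementary s (column W zero) (δ zero)
    condition : - 1# + s + - 1# * s * (δ zero · column W zero) ≈ 0#
    condition = begin
      - 1# + s + - 1# * s * (δ zero · column W zero)  ≈⟨ +-congˡ (*-congˡ (sumF-δˡ zero (column W zero))) ⟩
      - 1# + s + - 1# * s * w                         ≈⟨ rearrange s w ⟩
      (1# - w) * s - 1#                               ≈⟨ +-congʳ (x*x⁻¹≈1 1-w≉0) ⟩
      1# - 1#                                         ≈⟨ -‿inverseʳ 1# ⟩
      0#                                              ∎
      where
      rearrange : ∀ s w → - 1# + s + - 1# * s * w ≈ (1# - w) * s - 1#
      rearrange = solve 2 (λ s w → :- :1 :+ s :+ :- :1 :* s :* w := (:1 :- w) :* s :- :1) refl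
    YR≈Y-E₀₀ : (Y *M R) ≈M (Y -M E₀₀)
    YR≈Y-E₀₀ i j = begin
      Y i · column R j                               ≈⟨ ·-elementary (- 1#) (column W zero) (δ zero) (Y i) j ⟩
      Y i j + - 1# * ((Y *M W) i zero * δ zero j)    ≈⟨ +-congˡ (-1*x≈-x _) ⟩
      Y i j - (Y *M W) i zero * δ zero j             ≈⟨ +-congˡ (-‿cong (*-congʳ YW₀≈δ₀)) ⟩
      Y i j - E₀₀ i j                                ∎
      where
      YW₀≈δ₀ : (Y *M W) i zero ≈ δ zero i
      YW₀≈δ₀ = trans (YW≈I i zero) (trans (I≈δ i zero) (reflexive (δ-sym i zero)))

module CayleyGraph {c ℓ} (F : FiniteField c ℓ) where
  open FiniteField F hiding (zero)
  open Matrices F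
  open MatrixAlgebra F
  open import Algebra.Properties.Group +-group using () renaming (⁻¹-involutive to -‿involutive)
  open import Algebra.Properties.AbelianGroup +-abelianGroup using (⁻¹-anti-homo‿-)

  CommonNeighbour : ∀ {n} → Mat n → Mat n → Mat n → Set (c ⊔ ℓ)
  CommonNeighbour x y z = UnitaryAdj x z × UnitaryAdj y z

  UnitaryAdj-sym : ∀ {n} {x y : Mat n} → UnitaryAdj x y → UnitaryAdj y x
  UnitaryAdj-sym = Invertible-neg (λ i j → sym (⁻¹-anti-homo‿- _ _))

  UnitaryAdj-respʳ : ∀ {n} {x y y′ : Mat n} → y ≈M y′ → UnitaryAdj x y → UnitaryAdj x y′
  UnitaryAdj-respʳ y≈y′ = Invertible-cong (λ i j → +-congˡ (-‿cong (y≈y′ i j)))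

  UnitaryAdj-respˡ : ∀ {n} {x x′ y : Mat n} → x ≈M x′ → UnitaryAdj x y → UnitaryAdj x′ y
  UnitaryAdj-respˡ x≈x′ = Invertible-cong (λ i j → +-congʳ (x≈x′ i j))

  CommonNeighbour-resp : ∀ {n} {x y z z′ : Mat n} → z ≈M z′ → CommonNeighbour x y z → CommonNeighbour x y z′
  CommonNeighbour-resp {x = x} {y} z≈z′ (x~z , y~z) =
    UnitaryAdj-respʳ {x = x} z≈z′ x~z , UnitaryAdj-respʳ {x = y} z≈z′ y~z

  UnitaryAdj-0M⇒Invertible : ∀ {n} {y : Mat n} → UnitaryAdj 0M y → Invertible y
  UnitaryAdj-0M⇒Invertible = Invertible-neg (λ i j → sym (trans (-‿cong (+-identityˡ _)) (-‿involutive _)))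

  Invertible⇒UnitaryAdj-0M : ∀ {n} {y : Mat n} → Invertible y → UnitaryAdj 0M y
  Invertible⇒UnitaryAdj-0M = Invertible-neg (λ i j → +-identityˡ _)

  sandwich-cancel : ∀ {n} {L L′ R R′ : Mat n} → (L′ *M L) ≈M I → (R *M R′) ≈M I →
    ∀ A → ((L′ *M ((L *M A) *M R)) *M R′) ≈M A
  sandwich-cancel {L = L} {L′} {R} {R′} L′L≈I RR′≈I A =
    ≈M-trans (*M-assoc L′ _ R′) (≈M-trans (*M-cong ≈M-refl (*M-assoc (L *M A) R R′))
    (≈M-trans (*M-cong ≈M-refl (≈M-trans (*M-cong ≈M-refl RR′≈I) (*M-identityʳ (L *M A))))
    (≈M-trans (≈M-sym (*M-assoc L′ L A)) (≈M-trans (*M-cong L′L≈I ≈M-refl) (*M-identityˡ A)))))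

  sandwich-cong : ∀ {n} (L R : Mat n) {A B : Mat n} → A ≈M B → ((L *M A) *M R) ≈M ((L *M B) *M R)
  sandwich-cong L R A≈B = *M-cong (*M-cong ≈M-refl A≈B) ≈M-refl

  sandwich-zero : ∀ {n} (L R : Mat n) → ((L *M 0M) *M R) ≈M 0M
  sandwich-zero L R = ≈M-trans (*M-cong (*M-zeroʳ L) (≈M-refl {x = R})) (*M-zeroˡ R)

  sandwich-M : ∀ {n} (L R A B : Mat n) → (((L *M A) *M R) -M ((L *M B) *M R)) ≈M ((L *M (A -M B)) *M R)
  sandwich-M L R A B = ≈M-sym (≈M-trans (*M-cong (*M-distribˡ-M L A B) ≈M-refl) (*M-distribʳ-M (L *M A) (L *M B) R))

  Invertible-sandwich : ∀ {n} {L R A : Mat n} → Invertible L → Invertible R → Invertible A → Invertible ((L *M A) *M R)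
  Invertible-sandwich L-inv R-inv A-inv = Invertible-* (Invertible-* L-inv A-inv) R-inv

  module Affine {n} {L L′ R R′ : Mat n} (LL′≈I : (L *M L′) ≈M I) (L′L≈I : (L′ *M L) ≈M I)
                (RR′≈I : (R *M R′) ≈M I) (R′R≈I : (R′ *M R) ≈M I) (y : Mat n) where

    φ ψ : Mat n → Mat n
    φ z = ((L *M z) *M R) +M y
    ψ w = (L′ *M (w -M y)) *M R′

    φ-cong : ∀ {z z′} → z ≈M z′ → φ z ≈M φ z′
    φ-cong z≈z′ i j = +-congʳ (sandwich-cong L R z≈z′ i j)

    ψ-cong : ∀ {w w′} → w ≈M w′ → ψ w ≈M ψ w′
    ψ-cong w≈w′ = sandwich-cong L′ R′ (λ i j → +-congʳ (w≈w′ i j))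

    ψφ≈id : ∀ z → ψ (φ z) ≈M z
    ψφ≈id z = ≈M-trans (sandwich-cong L′ R′ (λ i j → x+y-y≈x _ (y i j))) (sandwich-cancel L′L≈I RR′≈I z)

    φψ≈id : ∀ w → φ (ψ w) ≈M w
    φψ≈id w i j = trans (+-congʳ (sandwich-cancel LL′≈I R′R≈I (w -M y) i j)) (x-y+y≈x (w i j) (y i j))

    φ-adj : ∀ {a z} → UnitaryAdj a z → UnitaryAdj (φ a) (φ z)
    φ-adj {a} {z} adj =
      Invertible-cong (≈M-trans (≈M-sym (sandwich-M L R a z)) (λ i j → sym (+-cancel-y _ _ (y i j))))
      (Invertible-sandwich (L′ , LL′≈I , L′L≈I) (R′ , RR′≈I , R′R≈I) adj)
      where
      +-cancel-y : ∀ a b c → (a + c) - (b + c) ≈ a - b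
      +-cancel-y = solve 3 (λ a b c → (a :+ c) :- (b :+ c) := a :- b) refl

    ψ-adj : ∀ {a w} → UnitaryAdj a w → UnitaryAdj (ψ a) (ψ w)
    ψ-adj {a} {w} adj =
      Invertible-cong (≈M-trans (sandwich-cong L′ R′ (λ i j → sym (-‿cancel-y (a i j) (w i j) (y i j))))
                                (≈M-sym (sandwich-M L′ R′ (a -M y) (w -M y))))
      (Invertible-sandwich (L , L′L≈I , LL′≈I) (R , R′R≈I , RR′≈I) adj)
      where
      -‿cancel-y : ∀ a b c → (a - c) - (b - c) ≈ a - b
      -‿cancel-y = solve 3 (λ a b c → (a :- c) :- (b :- c) := a :- b) refl

    open Counting (Mat-setoid n) using (HasSize-bijection)

    HasSize-CommonNeighbour : ∀ {a b k} → HasSize _≈M_ (CommonNeighbour a b) k →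
      HasSize _≈M_ (CommonNeighbour (φ a) (φ b)) k
    HasSize-CommonNeighbour {a} {b} = HasSize-bijection φ ψ
      (λ (a~z , b~z) → φ-adj a~z , φ-adj b~z)
      (λ (φa~w , φb~w) → pull φa~w , pull φb~w)
      φ-cong ψ-cong ψφ≈id φψ≈id
      where
      pull : ∀ {a w} → UnitaryAdj (φ a) w → UnitaryAdj a (ψ w)
      pull φa~w = UnitaryAdj-respˡ (ψφ≈id _) (ψ-adj φa~w)

    HasSize-Neighbour : ∀ {a k} → HasSize _≈M_ (UnitaryAdj a) k → HasSize _≈M_ (UnitaryAdj (φ a)) k
    HasSize-Neighbour = HasSize-bijection φ ψ φ-adj (UnitaryAdj-respˡ (ψφ≈id _) ∘ ψ-adj) φ-cong ψ-cong ψφ≈id φψ≈id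

  module _ {n : ℕ} where
    open Counting (Mat-setoid n) using (HasSize-⇔)

    HasSize-CommonNeighbour-transfer : ∀ {k} {L R T x y : Mat n} → Invertible L → Invertible R →
      (x -M y) ≈M ((L *M T) *M R) → HasSize _≈M_ (CommonNeighbour T 0M) k → HasSize _≈M_ (CommonNeighbour x y) k
    HasSize-CommonNeighbour-transfer {L = L} {R} {T} {x} {y} (L′ , LL′≈I , L′L≈I) (R′ , RR′≈I , R′R≈I) x-y≈LTR size =
      HasSize-⇔ (λ (p , q) → UnitaryAdj-respˡ φT≈x p , UnitaryAdj-respˡ φ0≈y q)
                (λ (p , q) → UnitaryAdj-respˡ (≈M-sym φT≈x) p , UnitaryAdj-respˡ (≈M-sym φ0≈y) q)
                (HasSize-CommonNeighbour size)
      where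
      open Affine LL′≈I L′L≈I RR′≈I R′R≈I y
      φT≈x : φ T ≈M x
      φT≈x i j = trans (+-congʳ (sym (x-y≈LTR i j))) (x-y+y≈x (x i j) (y i j))
      φ0≈y : φ 0M ≈M y
      φ0≈y i j = trans (+-congʳ (sandwich-zero L R i j)) (+-identityˡ (y i j))

    HasSize-Neighbour-transfer : ∀ {k} (x : Mat n) → HasSize _≈M_ (UnitaryAdj 0M) k → HasSize _≈M_ (UnitaryAdj x) k
    HasSize-Neighbour-transfer x size = HasSize-⇔ (UnitaryAdj-respˡ φ0≈x) (UnitaryAdj-respˡ (≈M-sym φ0≈x)) (HasSize-Neighbour size)
      where
      open Affine (*M-identityˡ I) (*M-identityˡ I) (*M-identityˡ I) (*M-identityˡ I) x
      φ0≈x : φ 0M ≈M x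
      φ0≈x i j = trans (+-congʳ (sandwich-zero I I i j)) (+-identityˡ (x i j))

  zero-column⇒¬UnitaryAdj-0M : ∀ {n} {X : Mat n} (k : Fin n) → (∀ i → X i k ≈ 0#) → ¬ UnitaryAdj X 0M
  zero-column⇒¬UnitaryAdj-0M k Xk≈0 =
    zero-column⇒¬Invertible k (λ i → trans (+-cong (Xk≈0 i) -0≈0) (+-identityʳ 0#))

  E₀₀≉0M : ∀ {m} → ¬ E₀₀ {m} ≈M 0M
  E₀₀≉0M E≈0 = 1≉0 (trans (sym (*-identityʳ 1#)) (E≈0 zero zero))

  ¬UnitaryAdj-E₀₀-0M : ∀ {m} → ¬ UnitaryAdj (E₀₀ {suc m}) 0M
  ¬UnitaryAdj-E₀₀-0M = zero-column⇒¬UnitaryAdj-0M {X = E₀₀} (suc zero) (λ i → zeroʳ _)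

  Invertible₁ : ∀ {M : Mat 1} → ¬ M zero zero ≈ 0# → Invertible M
  Invertible₁ {M} M₀₀≉0 = M⁻¹ , ≈δ⇒≈I {X = M *M M⁻¹} MM⁻¹≈δ , ≈δ⇒≈I {X = M⁻¹ *M M} M⁻¹M≈δ
    where
    M⁻¹ : Mat 1
    M⁻¹ _ _ = x⁻¹ M₀₀≉0
    MM⁻¹≈δ : ∀ i j → (M *M M⁻¹) i j ≈ δ i j
    MM⁻¹≈δ zero zero = trans (+-identityʳ _) (x*x⁻¹≈1 M₀₀≉0)
    M⁻¹M≈δ : ∀ i j → (M⁻¹ *M M) i j ≈ δ i j
    M⁻¹M≈δ zero zero = trans (+-identityʳ _) (trans (*-comm _ _) (x*x⁻¹≈1 M₀₀≉0))

  ¬UnitaryCayleyGraphSRG₁ : ¬ UnitaryCayleyGraphSRG 1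
  ¬UnitaryCayleyGraphSRG₁ (_ , _ , _ , _ , _ , _ , _ , _ , _ , x , y , x≉y , ¬x~y)
    with (x zero zero - y zero zero) ≟ 0#
  ... | yes x₀₀-y₀₀≈0 = x≉y λ { zero zero → x-y≈0⇒x≈y x₀₀-y₀₀≈0 }
  ... | no x₀₀-y₀₀≉0  = ¬x~y (Invertible₁ {x -M y} x₀₀-y₀₀≉0)

module TwoByTwo {c ℓ} (F : FiniteField c ℓ) where
  open FiniteField F hiding (zero)
  open Matrices F
  open MatrixAlgebra F
  open CayleyGraph F
  open import Relation.Binary.Reasoning.Setoid setoid

  fin₁ : Fin 2
  fin₁ = suc zero

  mat₂ : Carrier → Carrier → Carrier → Carrier → Mat 2
  mat₂ a b c d zero       zero       = a
  mat₂ a b c d zero       (suc zero) = b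
  mat₂ a b c d (suc zero) zero       = c
  mat₂ a b c d (suc zero) (suc zero) = d

  det : Mat 2 → Carrier
  det M = M zero zero * M fin₁ fin₁ - M zero fin₁ * M fin₁ zero

  det-cong : ∀ {A B : Mat 2} → A ≈M B → det A ≈ det B
  det-cong A≈B = +-cong (*-cong (A≈B zero zero) (A≈B fin₁ fin₁)) (-‿cong (*-cong (A≈B zero fin₁) (A≈B fin₁ zero)))

  det-*M : ∀ (A B : Mat 2) → det (A *M B) ≈ det A * det B
  det-*M A B = multiplicative (A zero zero) (A zero fin₁) (A fin₁ zero) (A fin₁ fin₁)
                              (B zero zero) (B zero fin₁) (B fin₁ zero) (B fin₁ fin₁)
    where
    multiplicative : ∀ a b c d e f g h →
      (a * e + (b * g + 0#)) * (c * f + (d * h + 0#)) - (a * f + (b * h + 0#)) * (c * e + (d * g + 0#))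
        ≈ (a * d - b * c) * (e * h - f * g)
    multiplicative = solve 8 (λ a b c d e f g h →
      (a :* e :+ (b :* g :+ :0)) :* (c :* f :+ (d :* h :+ :0)) :- (a :* f :+ (b :* h :+ :0)) :* (c :* e :+ (d :* g :+ :0))
        := (a :* d :- b :* c) :* (e :* h :- f :* g)) refl

  det-I : det I ≈ 1#
  det-I = trans (det-cong {B = δ} I≈δ) (solve 0 (:1 :* :1 :- :0 :* :0 := :1) refl)

  Invertible⇒det≉0 : ∀ {M : Mat 2} → Invertible M → ¬ det M ≈ 0#
  Invertible⇒det≉0 {M} (M⁻¹ , MM⁻¹≈I , _) det≈0 = 1≉0 (begin
    1#                ≈⟨ det-I ⟨
    det I             ≈⟨ det-cong MM⁻¹≈I ⟨
    det (M *M M⁻¹)    ≈⟨ det-*M M M⁻¹ ⟩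
    det M * det M⁻¹   ≈⟨ *-congʳ det≈0 ⟩
    0# * det M⁻¹      ≈⟨ zeroˡ _ ⟩
    0#                ∎)

  det≉0⇒Invertible : ∀ {M : Mat 2} → ¬ det M ≈ 0# → Invertible M
  det≉0⇒Invertible {M} det≉0 = M⁻¹ , ≈δ⇒≈I MM⁻¹≈δ , ≈δ⇒≈I M⁻¹M≈δ
    where
    a = M zero zero
    b = M zero fin₁
    c′ = M fin₁ zero
    d = M fin₁ fin₁
    s = x⁻¹ det≉0
    M⁻¹ : Mat 2
    M⁻¹ = mat₂ (s * d) (s * - b) (s * - c′) (s * a)
    diagonal : ∀ {x} → x ≈ det M * s → x ≈ 1#
    diagonal x≈ = trans x≈ (x*x⁻¹≈1 det≉0)
    MM⁻¹≈δ : ∀ i j → (M *M M⁻¹) i j ≈ δ i j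
    MM⁻¹≈δ zero       zero       = diagonal (solve 5
      (λ a b c d s → a :* (s :* d) :+ (b :* (s :* :- c) :+ :0) := (a :* d :- b :* c) :* s) refl a b c′ d s)
    MM⁻¹≈δ zero       (suc zero) = solve 3 (λ a b s → a :* (s :* :- b) :+ (b :* (s :* a) :+ :0) := :0) refl a b s
    MM⁻¹≈δ (suc zero) zero       = solve 3 (λ c d s → c :* (s :* d) :+ (d :* (s :* :- c) :+ :0) := :0) refl c′ d s
    MM⁻¹≈δ (suc zero) (suc zero) = diagonal (solve 5
      (λ a b c d s → c :* (s :* :- b) :+ (d :* (s :* a) :+ :0) := (a :* d :- b :* c) :* s) refl a b c′ d s)
    M⁻¹M≈δ : ∀ i j → (M⁻¹ *M M) i j ≈ δ i j
    M⁻¹M≈δ zero       zero       = diagonal (solve 5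
      (λ a b c d s → (s :* d) :* a :+ ((s :* :- b) :* c :+ :0) := (a :* d :- b :* c) :* s) refl a b c′ d s)
    M⁻¹M≈δ zero       (suc zero) = solve 3 (λ b d s → (s :* d) :* b :+ ((s :* :- b) :* d :+ :0) := :0) refl b d s
    M⁻¹M≈δ (suc zero) zero       = solve 3 (λ a c s → (s :* :- c) :* a :+ ((s :* a) :* c :+ :0) := :0) refl a c′ s
    M⁻¹M≈δ (suc zero) (suc zero) = diagonal (solve 5
      (λ a b c d s → (s :* :- c) :* b :+ ((s :* a) :* d :+ :0) := (a :* d :- b :* c) :* s) refl a b c′ d s)

  Invertible? : ∀ (M : Mat 2) → Dec (Invertible M)
  Invertible? M with det M ≟ 0#
  ... | yes det≈0 = no (λ M-inv → Invertible⇒det≉0 {M} M-inv det≈0)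
  ... | no det≉0  = yes (det≉0⇒Invertible {M} det≉0)

  det-singularˡ : ∀ (S D : Mat 2) → det D ≈ 0# → det (S *M D) ≈ 0#
  det-singularˡ S D det≈0 = trans (det-*M S D) (trans (*-congˡ det≈0) (zeroʳ _))

  det-singularʳ : ∀ (D S : Mat 2) → det D ≈ 0# → det (D *M S) ≈ 0#
  det-singularʳ D S det≈0 = trans (det-*M D S) (trans (*-congʳ det≈0) (zeroˡ _))

  RankOneNormalForm : Mat 2 → Set (c ⊔ ℓ)
  RankOneNormalForm D = ∃₂ λ P Q → Invertible P × Invertible Q × ((P *M D) *M Q) ≈M E₀₀

  normal-form-liftˡ : ∀ {S D : Mat 2} → Invertible S → RankOneNormalForm (S *M D) → RankOneNormalForm D
  normal-form-liftˡ {S} {D} S-inv (P , Q , P-inv , Q-inv , PSDQ≈E) =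
    P *M S , Q , Invertible-* {A = P} {B = S} P-inv S-inv , Q-inv ,
    ≈M-trans (*M-cong (*M-assoc P S D) (≈M-refl {x = Q})) PSDQ≈E

  normal-form-liftʳ : ∀ {D S : Mat 2} → Invertible S → RankOneNormalForm (D *M S) → RankOneNormalForm D
  normal-form-liftʳ {D} {S} S-inv (P , Q , P-inv , Q-inv , PDSQ≈E) =
    P , S *M Q , P-inv , Invertible-* {A = S} {B = Q} S-inv Q-inv ,
    ≈M-trans (≈M-sym (*M-assoc (P *M D) S Q)) (≈M-trans (*M-cong (*M-assoc P D S) (≈M-refl {x = Q})) PDSQ≈E)

  -- Clear the first row and column with the pivot a = D₀₀ and s = a⁻¹; the remaining entry
  -- is det D / a, hence 0.  Each entry differs from that of E₀₀ by multiples of 1 - a s and det D.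
  pivot-reduction : ∀ {D : Mat 2} {s} → 1# - D zero zero * s ≈ 0# → det D ≈ 0# →
    ((mat₂ s 0# (- (D fin₁ zero * s)) 1# *M D) *M mat₂ 1# (- (D zero fin₁ * s)) 0# 1#) ≈M E₀₀
  pivot-reduction {D} {s} 1-as≈0 det≈0 = entries
    where
    a = D zero zero
    b = D zero fin₁
    c′ = D fin₁ zero
    d = D fin₁ fin₁
    residual : ∀ {t} x y → t + x * (1# - a * s) + y * det D ≈ t
    residual {t} x y = begin
      t + x * (1# - a * s) + y * det D  ≈⟨ +-cong (+-congˡ (trans (*-congˡ 1-as≈0) (zeroʳ x))) (trans (*-congˡ det≈0) (zeroʳ y)) ⟩
      t + 0# + 0#                       ≈⟨ solve 1 (λ t → t :+ :0 :+ :0 := t) refl t ⟩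
      t                                 ∎
    P Q : Mat 2
    P = mat₂ s 0# (- (c′ * s)) 1#
    Q = mat₂ 1# (- (b * s)) 0# 1#
    entries : ∀ i j → ((P *M D) *M Q) i j ≈ E₀₀ i j
    entries zero zero = trans (solve 5 (λ a b c d s →
        (s :* a :+ (:0 :* c :+ :0)) :* :1 :+ ((s :* b :+ (:0 :* d :+ :0)) :* :0 :+ :0)
          := :1 :* :1 :+ (:- :1) :* (:1 :- a :* s) :+ :0 :* (a :* d :- b :* c)) refl a b c′ d s)
      (residual (- 1#) 0#)
    entries zero (suc zero) = trans (solve 5 (λ a b c d s →
        (s :* a :+ (:0 :* c :+ :0)) :* (:- (b :* s)) :+ ((s :* b :+ (:0 :* d :+ :0)) :* :1 :+ :0)
          := :1 :* :0 :+ (s :* b) :* (:1 :- a :* s) :+ :0 :* (a :* d :- b :* c)) refl a b c′ d s)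
      (residual (s * b) 0#)
    entries (suc zero) zero = trans (solve 5 (λ a b c d s →
        ((:- (c :* s)) :* a :+ (:1 :* c :+ :0)) :* :1 :+ (((:- (c :* s)) :* b :+ (:1 :* d :+ :0)) :* :0 :+ :0)
          := :0 :* :1 :+ c :* (:1 :- a :* s) :+ :0 :* (a :* d :- b :* c)) refl a b c′ d s)
      (residual c′ 0#)
    entries (suc zero) (suc zero) = trans (solve 5 (λ a b c d s →
        ((:- (c :* s)) :* a :+ (:1 :* c :+ :0)) :* (:- (b :* s)) :+ (((:- (c :* s)) :* b :+ (:1 :* d :+ :0)) :* :1 :+ :0)
          := :0 :* :0 :+ (d :- b :* s :* c) :* (:1 :- a :* s) :+ s :* (a :* d :- b :* c)) refl a b c′ d s)
      (residual (d - b * s * c′) s)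

  normal-form-pivot : ∀ {D : Mat 2} → ¬ D zero zero ≈ 0# → det D ≈ 0# → RankOneNormalForm D
  normal-form-pivot {D} a≉0 det≈0 =
    P , Q , det≉0⇒Invertible {P} det[P]≉0 , det≉0⇒Invertible {Q} det[Q]≉0 ,
    pivot-reduction {D} (trans (+-congˡ (-‿cong (x*x⁻¹≈1 a≉0))) (-‿inverseʳ 1#)) det≈0
    where
    s = x⁻¹ a≉0
    P Q : Mat 2
    P = mat₂ s 0# (- (D fin₁ zero * s)) 1#
    Q = mat₂ 1# (- (D zero fin₁ * s)) 0# 1#
    det[P]≉0 : ¬ det P ≈ 0#
    det[P]≉0 det[P]≈0 = 1≉0 (begin
      1#                ≈⟨ x*x⁻¹≈1 a≉0 ⟨
      D zero zero * s   ≈⟨ *-congˡ (trans (solve 2 (λ s x → s := s :* :1 :- :0 :* :- x) refl s (D fin₁ zero * s)) det[P]≈0) ⟩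
      D zero zero * 0#  ≈⟨ zeroʳ _ ⟩
      0#                ∎)
    det[Q]≉0 : ¬ det Q ≈ 0#
    det[Q]≉0 det[Q]≈0 = 1≉0 (trans (solve 1 (λ x → :1 := :1 :* :1 :- :- x :* :0) refl (D zero fin₁ * s)) det[Q]≈0)

  swap₂ : Mat 2
  swap₂ = mat₂ 0# 1# 1# 0#

  Invertible-swap₂ : Invertible swap₂
  Invertible-swap₂ = det≉0⇒Invertible {swap₂} (λ det≈0 → 1≉0 (begin
    1#                  ≈⟨ solve 0 (:1 := :- (:0 :* :0 :- :1 :* :1)) refl ⟩
    - det swap₂         ≈⟨ -‿cong det≈0 ⟩
    - 0#                ≈⟨ -0≈0 ⟩
    0#                  ∎))

  swap₂-*M : ∀ (D : Mat 2) j → (swap₂ *M D) zero j ≈ D fin₁ j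
  swap₂-*M D j = solve 2 (λ x y → :0 :* x :+ (:1 :* y :+ :0) := y) refl (D zero j) (D fin₁ j)

  *M-swap₂ : ∀ (D : Mat 2) i → (D *M swap₂) i zero ≈ D i fin₁
  *M-swap₂ D i = solve 2 (λ x y → x :* :0 :+ (y :* :1 :+ :0) := y) refl (D i zero) (D i fin₁)

  normal-form-row₀ : ∀ {D : Mat 2} → ¬ (D zero zero ≈ 0# × D zero fin₁ ≈ 0#) → det D ≈ 0# → RankOneNormalForm D
  normal-form-row₀ {D} row≉0 det≈0 with D zero zero ≟ 0#
  ... | no D₀₀≉0  = normal-form-pivot {D} D₀₀≉0 det≈0
  ... | yes D₀₀≈0 = normal-form-liftʳ {D} {swap₂} Invertible-swap₂
    (normal-form-pivot {D *M swap₂} (λ e → row≉0 (D₀₀≈0 , trans (sym (*M-swap₂ D zero)) e)) (det-singularʳ D swap₂ det≈0))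

  rank-one-normal-form : ∀ {D : Mat 2} → ¬ D ≈M 0M → det D ≈ 0# → RankOneNormalForm D
  rank-one-normal-form {D} D≉0 det≈0 with (D zero zero ≟ 0#) ×-dec (D zero fin₁ ≟ 0#)
  ... | no row₀≉0 = normal-form-row₀ {D} row₀≉0 det≈0
  ... | yes (D₀₀≈0 , D₀₁≈0) = normal-form-liftˡ {swap₂} {D} Invertible-swap₂
    (normal-form-row₀ {swap₂ *M D}
       (λ (e₀ , e₁) → D≉0 (D≈0 (trans (sym (swap₂-*M D zero)) e₀) (trans (sym (swap₂-*M D fin₁)) e₁)))
                      (det-singularˡ swap₂ D det≈0))
    where
    D≈0 : D fin₁ zero ≈ 0# → D fin₁ fin₁ ≈ 0# → D ≈M 0M
    D≈0 D₁₀≈0 D₁₁≈0 zero       zero       = D₀₀≈0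
    D≈0 D₁₀≈0 D₁₁≈0 zero       (suc zero) = D₀₁≈0
    D≈0 D₁₀≈0 D₁₁≈0 (suc zero) zero       = D₁₀≈0
    D≈0 D₁₀≈0 D₁₁≈0 (suc zero) (suc zero) = D₁₁≈0

  open Counting (Mat-setoid 2) using (HasSize-filter)

  Cardinality-Mat₂ : HasSize (_≈M_ {2}) (λ _ → ⊤ {ℓ = 0ℓ}) ((size ^ 2) ^ 2)
  Cardinality-Mat₂ = Cardinality-Vector (≋-setoid setoid 2)
    (Cardinality-Vector setoid (enum , _ , enum-inj , λ x _ → enum-sur x) 2) 2

  neighbourhood-size : ∃ λ k → HasSize _≈M_ (UnitaryAdj (0M {2})) k
  neighbourhood-size = HasSize-filter Cardinality-Mat₂ (λ z → Invertible? (0M -M z)) (UnitaryAdj-respʳ {x = 0M})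

  common-neighbourhood-size : ∀ (T : Mat 2) → ∃ λ k → HasSize _≈M_ (CommonNeighbour T 0M) k
  common-neighbourhood-size T = HasSize-filter Cardinality-Mat₂
    (λ z → Invertible? (T -M z) ×-dec Invertible? (0M -M z)) (CommonNeighbour-resp {x = T} {0M})

  unitaryCayleyGraph₂-SRG : UnitaryCayleyGraphSRG 2
  unitaryCayleyGraph₂-SRG =
    _ , _ , _ , _ , Cardinality-Mat₂ , degree , adjacent-common , non-adjacent-common ,
    (I , 0M , Invertible-cong {A = I} (λ i j → sym (trans (+-congˡ -0≈0) (+-identityʳ _))) Invertible-I) ,
    (E₀₀ , 0M , E₀₀≉0M , ¬UnitaryAdj-E₀₀-0M)
    where
    degree : ∀ x → HasSize _≈M_ (UnitaryAdj x) (proj₁ neighbourhood-size)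
    degree x = HasSize-Neighbour-transfer x (proj₂ neighbourhood-size)
    adjacent-common : ∀ x y → UnitaryAdj x y → HasSize _≈M_ (CommonNeighbour x y) (proj₁ (common-neighbourhood-size I))
    adjacent-common x y x~y = HasSize-CommonNeighbour-transfer {L = x -M y} {R = I} {T = I} x~y Invertible-I
      (≈M-sym (≈M-trans (*M-identityʳ ((x -M y) *M I)) (*M-identityʳ (x -M y))))
      (proj₂ (common-neighbourhood-size I))
    non-adjacent-common : ∀ x y → ¬ x ≈M y → ¬ UnitaryAdj x y →
      HasSize _≈M_ (CommonNeighbour x y) (proj₁ (common-neighbourhood-size E₀₀))
    non-adjacent-common x y x≉y ¬x~y with rank-one-normal-form {x -M y} D≉0 det≈0
      where
      D≉0 : ¬ (x -M y) ≈M 0M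
      D≉0 D≈0 = x≉y (λ i j → x-y≈0⇒x≈y (D≈0 i j))
      det≈0 : det (x -M y) ≈ 0#
      det≈0 with det (x -M y) ≟ 0#
      ... | yes det≈0 = det≈0
      ... | no det≉0  = ⊥-elim (¬x~y (det≉0⇒Invertible {x -M y} det≉0))
    ... | P , Q , (P′ , PP′≈I , P′P≈I) , (Q′ , QQ′≈I , Q′Q≈I) , PDQ≈E =
      HasSize-CommonNeighbour-transfer {L = P′} {Q′} {E₀₀} (P , P′P≈I , PP′≈I) (Q , Q′Q≈I , QQ′≈I)
        (≈M-trans (≈M-sym (sandwich-cancel {L = P} {P′} {Q} {Q′} P′P≈I QQ′≈I (x -M y)))
                  (sandwich-cong P′ Q′ PDQ≈E))
        (proj₂ (common-neighbourhood-size E₀₀))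

module DimensionAtLeastThree {c ℓ} (F : FiniteField c ℓ) (m : ℕ) where
  open FiniteField F hiding (zero)
  open Matrices F
  open MatrixAlgebra F
  open CayleyGraph F
  open import Relation.Binary.Reasoning.Setoid setoid

  n : ℕ
  n = suc (suc (suc m))

  fin₁ fin₂ : Fin n
  fin₁ = suc zero
  fin₂ = suc (suc zero)

  pair : Carrier → Carrier → Fin n → Carrier
  pair a b l = δ zero l * a + δ fin₁ l * b

  ·-pair : ∀ (f : Fin n → Carrier) a b → f · pair a b ≈ f zero * a + f fin₁ * b
  ·-pair f a b = begin
    sumF n (λ l → f l * (δ zero l * a + δ fin₁ l * b))
      ≈⟨ sumF-cong n (λ l → expand (f l) (δ zero l) a (δ fin₁ l) b) ⟩
    sumF n (λ l → δ zero l * (f l * a) + δ fin₁ l * (f l * b))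
      ≈⟨ sumF-+ n (λ l → δ zero l * (f l * a)) (λ l → δ fin₁ l * (f l * b)) ⟩
    sumF n (λ l → δ zero l * (f l * a)) + sumF n (λ l → δ fin₁ l * (f l * b))
      ≈⟨ +-cong (sumF-δˡ zero (λ l → f l * a)) (sumF-δˡ fin₁ (λ l → f l * b)) ⟩
    f zero * a + f fin₁ * b
      ∎
    where
    expand : ∀ f x a y b → f * (x * a + y * b) ≈ x * (f * a) + y * (f * b)
    expand = solve 5 (λ f x a y b → f :* (x :* a :+ y :* b) := x :* (f :* a) :+ y :* (f :* b)) refl

  E₀₀+E₁₁ : Mat n
  E₀₀+E₁₁ i = pair (δ zero i) (δ fin₁ i)

  E₀₀+E₁₁≉0M : ¬ E₀₀+E₁₁ ≈M 0M
  E₀₀+E₁₁≉0M B≈0 = 1≉0 (trans (solve 0 (:1 := :1 :* :1 :+ :0 :* :0) refl) (B≈0 zero zero))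

  ¬UnitaryAdj-E₀₀+E₁₁-0M : ¬ UnitaryAdj E₀₀+E₁₁ 0M
  ¬UnitaryAdj-E₀₀+E₁₁-0M = zero-column⇒¬UnitaryAdj-0M {X = E₀₀+E₁₁} fin₂
    (λ i → solve 2 (λ x y → :0 :* x :+ :0 :* y := :0) refl (δ zero i) (δ fin₁ i))

  cornerDet : Mat n → Carrier
  cornerDet W = (1# - W zero zero) * (1# - W fin₁ fin₁) - W zero fin₁ * W fin₁ zero

  cornerDet-cong : ∀ {W W′ : Mat n} → W ≈M W′ → cornerDet W ≈ cornerDet W′
  cornerDet-cong W≈W′ = +-cong (*-cong (+-congˡ (-‿cong (W≈W′ zero zero))) (+-congˡ (-‿cong (W≈W′ fin₁ fin₁))))
                               (-‿cong (*-cong (W≈W′ zero fin₁) (W≈W′ fin₁ zero)))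

  record IsInverse (Y W : Mat n) : Set ℓ where
    constructor _,_
    field
      inverseʳ : (Y *M W) ≈M I
      inverseˡ : (W *M Y) ≈M I
  open IsInverse

  IsInverse-unique : ∀ {Y Y′ W W′ : Mat n} → Y ≈M Y′ → IsInverse Y W → IsInverse Y′ W′ → W ≈M W′
  IsInverse-unique {Y} {Y′} {W} {W′} Y≈Y′ Y⇄W Y′⇄W′ = inverse-unique {A = Y′} {W} {W′}
    (≈M-trans (*M-cong (≈M-sym Y≈Y′) (≈M-refl {x = W})) (inverseʳ Y⇄W)) (inverseˡ Y′⇄W′)

  [Y-B]W-pair : ∀ {Y W : Mat n} → (Y *M W) ≈M I → ∀ u₀ u₁ i →
    ((Y -M E₀₀+E₁₁) *v (W *v pair u₀ u₁)) i
      ≈ δ zero i * ((1# - W zero zero) * u₀ + - W zero fin₁ * u₁) + δ fin₁ i * (- W fin₁ zero * u₀ + (1# - W fin₁ fin₁) * u₁)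
  [Y-B]W-pair {Y} {W} YW≈I u₀ u₁ i = begin
    ((Y -M E₀₀+E₁₁) *v x) i
      ≈⟨ -M-*v Y E₀₀+E₁₁ x i ⟩
    (Y *v x) i - E₀₀+E₁₁ i · x
      ≈⟨ +-cong (*v-inverseʳ {Y = Y} {W} YW≈I (pair u₀ u₁) i) (-‿cong (trans (·-comm (E₀₀+E₁₁ i) x) (·-pair x _ _))) ⟩
    pair u₀ u₁ i - (x zero * δ zero i + x fin₁ * δ fin₁ i)
      ≈⟨ +-congˡ (-‿cong (+-cong (*-congʳ (·-pair (W zero) u₀ u₁)) (*-congʳ (·-pair (W fin₁) u₀ u₁)))) ⟩
    (δ zero i * u₀ + δ fin₁ i * u₁)
      - ((W zero zero * u₀ + W zero fin₁ * u₁) * δ zero i + (W fin₁ zero * u₀ + W fin₁ fin₁ * u₁) * δ fin₁ i)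
      ≈⟨ regroup (δ zero i) (δ fin₁ i) u₀ u₁ (W zero zero) (W zero fin₁) (W fin₁ zero) (W fin₁ fin₁) ⟩
    δ zero i * ((1# - W zero zero) * u₀ + - W zero fin₁ * u₁) + δ fin₁ i * (- W fin₁ zero * u₀ + (1# - W fin₁ fin₁) * u₁)
      ∎
    where
    x : Fin n → Carrier
    x = W *v pair u₀ u₁
    regroup : ∀ p q u₀ u₁ a b c d →
      (p * u₀ + q * u₁) - ((a * u₀ + b * u₁) * p + (c * u₀ + d * u₁) * q)
        ≈ p * ((1# - a) * u₀ + - b * u₁) + q * (- c * u₀ + (1# - d) * u₁)
    regroup = solve 8 (λ p q u₀ u₁ a b c d →
      (p :* u₀ :+ q :* u₁) :- ((a :* u₀ :+ b :* u₁) :* p :+ (c :* u₀ :+ d :* u₁) :* q)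
        := p :* ((:1 :- a) :* u₀ :+ :- b :* u₁) :+ q :* (:- c :* u₀ :+ (:1 :- d) :* u₁)) refl

  cornerDet≈0⇒¬UnitaryAdj : ∀ {Y W : Mat n} → (Y *M W) ≈M I → cornerDet W ≈ 0# → ¬ UnitaryAdj Y E₀₀+E₁₁
  cornerDet≈0⇒¬UnitaryAdj {Y} {W} YW≈I cornerDet≈0 Y~B
    with singular₂⇒kernel (1# - W zero zero) (- W zero fin₁) (- W fin₁ zero) (1# - W fin₁ fin₁)
           (trans (+-congˡ (-‿cong (-x*-y≈x*y _ _))) cornerDet≈0)
  ... | u₀ , u₁ , u≉0 , row₀ , row₁ = u≉0
    (trans (solve 2 (λ a b → a := :1 :* a :+ :0 :* b) refl u₀ u₁) (u≈0 zero) ,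
     trans (solve 2 (λ a b → b := :0 :* a :+ :1 :* b) refl u₀ u₁) (u≈0 fin₁))
    where
    Wu≈0 : ∀ i → (W *v pair u₀ u₁) i ≈ 0#
    Wu≈0 = Invertible-kernel {M = Y -M E₀₀+E₁₁} Y~B (W *v pair u₀ u₁) λ i →
      trans ([Y-B]W-pair {Y} {W} YW≈I u₀ u₁ i)
        (trans (+-cong (*-congˡ row₀) (*-congˡ row₁)) (solve 2 (λ p q → p :* :0 :+ q :* :0 := :0) refl (δ zero i) (δ fin₁ i)))
    u≈0 : ∀ i → pair u₀ u₁ i ≈ 0#
    u≈0 i = trans (sym (*v-inverseʳ {Y = Y} {W} YW≈I (pair u₀ u₁) i)) (trans (*v-cong Y Wu≈0 i) (*M-zeroʳ Y i i))

  shear : Carrier → Mat n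
  shear t = elementary t (δ zero) (δ fin₁)

  shear-inverse : ∀ {t t′} → t + t′ ≈ 0# → IsInverse (shear t) (shear t′)
  shear-inverse {t} {t′} t+t′≈0 = proj₁ product≈I , proj₂ product≈I
    where
    product≈I : (shear t *M shear t′) ≈M I × (shear t′ *M shear t) ≈M I
    product≈I = elementary-inverse (begin
      t + t′ + t * t′ * (δ fin₁ · δ zero)  ≈⟨ +-congˡ (*-congˡ (sumF-δˡ fin₁ (δ zero))) ⟩
      t + t′ + t * t′ * 0#                 ≈⟨ +-congˡ (zeroʳ _) ⟩
      t + t′ + 0#                          ≈⟨ +-identityʳ _ ⟩
      t + t′                               ≈⟨ t+t′≈0 ⟩
      0#                                   ∎)

  shear-*M : ∀ t (W : Mat n) i j → (shear t *M W) i j ≈ W i j + t * (δ zero i * W fin₁ j)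
  shear-*M t W i j = trans (elementary-*v t (δ zero) (δ fin₁) (column W j) i)
                           (+-congˡ (*-congˡ (*-congˡ (sumF-δˡ fin₁ (column W j)))))

  HasInverseWithCorner≉1 : Mat n → Set (c ⊔ ℓ)
  HasInverseWithCorner≉1 Y = ∃ λ W → IsInverse Y W × ¬ W zero zero ≈ 1#

  HasInverseWithCorner≉1⇒CommonNeighbour : ∀ {Y} → HasInverseWithCorner≉1 Y → CommonNeighbour E₀₀ 0M Y
  HasInverseWithCorner≉1⇒CommonNeighbour {Y} (W , (YW≈I , WY≈I) , W₀₀≉1) =
    UnitaryAdj-sym {x = Y} {E₀₀} (Invertible-minus-E₀₀ {Y = Y} {W} YW≈I WY≈I W₀₀≉1) ,
    Invertible⇒UnitaryAdj-0M {y = Y} (W , YW≈I , WY≈I)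

  -- Y shear(t) has inverse G = shear(-t) W, with t = W₀₁ chosen to move the corner entry off 1.
  module Sheared {Y W : Mat n} (Y⇄W : IsInverse Y W) where
    t : Carrier
    t = W zero fin₁

    G : Mat n
    G = shear (- t) *M W

    Y⇄G : IsInverse (Y *M shear t) G
    Y⇄G = inverse-of-* {A = Y} {W} {shear t} {shear (- t)} (inverseʳ Y⇄W) (inverseʳ shear-t⇄-t) ,
          inverse-of-* {A = shear (- t)} {shear t} {W} {Y} (inverseˡ shear-t⇄-t) (inverseˡ Y⇄W)
      where
      shear-t⇄-t : IsInverse (shear t) (shear (- t))
      shear-t⇄-t = shear-inverse (-‿inverseʳ t)

    G₁₀≈W₁₀ : G fin₁ zero ≈ W fin₁ zero
    G₁₀≈W₁₀ = trans (shear-*M (- t) W fin₁ zero)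
                    (trans (+-congˡ (trans (*-congˡ (zeroˡ _)) (zeroʳ _))) (+-identityʳ _))

    1-G₀₀≈1-W₀₀+tW₁₀ : 1# - G zero zero ≈ (1# - W zero zero) + t * W fin₁ zero
    1-G₀₀≈1-W₀₀+tW₁₀ = trans (+-congˡ (-‿cong (shear-*M (- t) W zero zero)))
      (solve 3 (λ a t c → :1 :- (a :+ :- t :* (:1 :* c)) := (:1 :- a) :+ t :* c) refl (W zero zero) t (W fin₁ zero))

    cornerDet-G : cornerDet G ≈ (1# - W zero zero) * (1# - W fin₁ fin₁)
    cornerDet-G = begin
      cornerDet G  ≈⟨ cornerDet-cong (shear-*M (- t) W) ⟩
      (1# - (a + - t * (1# * c′))) * (1# - (d + - t * (0# * d))) - (t + - t * (1# * d)) * (c′ + - t * (0# * c′))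
                   ≈⟨ solve 4 (λ a t c d →
                        (:1 :- (a :+ :- t :* (:1 :* c))) :* (:1 :- (d :+ :- t :* (:0 :* d)))
                          :- (t :+ :- t :* (:1 :* d)) :* (c :+ :- t :* (:0 :* c))
                        := (:1 :- a) :* (:1 :- d)) refl a t c′ d ⟩
      (1# - a) * (1# - d) ∎
      where
      a = W zero zero
      c′ = W fin₁ zero
      d = W fin₁ fin₁

    module _ (W₀₀≈1 : W zero zero ≈ 1#) where
      1-W₀₀≈0 : 1# - W zero zero ≈ 0#
      1-W₀₀≈0 = trans (+-congˡ (-‿cong W₀₀≈1)) (-‿inverseʳ 1#)

      cornerDet≈-tW₁₀ : cornerDet W ≈ - (t * W fin₁ zero)
      cornerDet≈-tW₁₀ = trans (+-congʳ (trans (*-congʳ 1-W₀₀≈0) (zeroˡ _))) (+-identityˡ _)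

      cornerDet-G≈0 : cornerDet G ≈ 0#
      cornerDet-G≈0 = trans cornerDet-G (trans (*-congʳ 1-W₀₀≈0) (zeroˡ _))

      1-G₀₀≈tW₁₀ : 1# - G zero zero ≈ t * W fin₁ zero
      1-G₀₀≈tW₁₀ = trans 1-G₀₀≈1-W₀₀+tW₁₀ (trans (+-congʳ 1-W₀₀≈0) (+-identityˡ _))

      module _ (cornerDet≉0 : ¬ cornerDet W ≈ 0#) where
        tW₁₀≉0 : ¬ t * W fin₁ zero ≈ 0#
        tW₁₀≉0 tW₁₀≈0 = cornerDet≉0 (trans cornerDet≈-tW₁₀ (trans (-‿cong tW₁₀≈0) -0≈0))

        W₁₀≉0 : ¬ W fin₁ zero ≈ 0#
        W₁₀≉0 W₁₀≈0 = tW₁₀≉0 (trans (*-congˡ W₁₀≈0) (zeroʳ t))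

        G₀₀≉1 : ¬ G zero zero ≈ 1#
        G₀₀≉1 G₀₀≈1 = tW₁₀≉0 (begin
          t * W fin₁ zero    ≈⟨ 1-G₀₀≈tW₁₀ ⟨
          1# - G zero zero   ≈⟨ +-congˡ (-‿cong G₀₀≈1) ⟩
          1# - 1#            ≈⟨ -‿inverseʳ 1# ⟩
          0#                 ∎)

  unshear : ∀ (Z : Mat n) {t t′} → t + t′ ≈ 0# → ((Z *M shear t) *M shear t′) ≈M Z
  unshear Z {t} {t′} t+t′≈0 =
    ≈M-trans (*M-assoc Z (shear t) (shear t′))
      (≈M-trans (*M-cong (≈M-refl {x = Z}) (inverseʳ (shear-inverse t+t′≈0))) (*M-identityʳ Z))

  image : ∀ {Y W : Mat n} → IsInverse Y W → Dec (W zero zero ≈ 1#) → Mat n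
  image {Y} Y⇄W (no _)  = Y
  image {Y} Y⇄W (yes _) = Y *M shear (Sheared.t Y⇄W)

  image-HasInverseWithCorner≉1 : ∀ {Y W : Mat n} (Y⇄W : IsInverse Y W) → ¬ cornerDet W ≈ 0# →
    (d : Dec (W zero zero ≈ 1#)) → HasInverseWithCorner≉1 (image Y⇄W d)
  image-HasInverseWithCorner≉1 {W = W} Y⇄W cornerDet≉0 (no W₀₀≉1) = W , Y⇄W , W₀₀≉1
  image-HasInverseWithCorner≉1 Y⇄W cornerDet≉0 (yes W₀₀≈1) = G , Y⇄G , G₀₀≉1 W₀₀≈1 cornerDet≉0
    where open Sheared Y⇄W

  image-injective : ∀ {Y W Y′ W′ : Mat n} (Y⇄W : IsInverse Y W) (Y′⇄W′ : IsInverse Y′ W′) →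
    ¬ cornerDet W ≈ 0# → ¬ cornerDet W′ ≈ 0# →
    (d : Dec (W zero zero ≈ 1#)) (d′ : Dec (W′ zero zero ≈ 1#)) → image Y⇄W d ≈M image Y′⇄W′ d′ → Y ≈M Y′
  image-injective Y⇄W Y′⇄W′ _ _ (no _) (no _) Y≈Y′ = Y≈Y′
  image-injective {Y} {W} {Y′} Y⇄W Y′⇄W′ cornerDet≉0 _ (no _) (yes W′₀₀≈1) Y≈Y′t′ =
    ⊥-elim (cornerDet≉0 (trans (cornerDet-cong W≈G′) (Sheared.cornerDet-G≈0 Y′⇄W′ W′₀₀≈1)))
    where
    W≈G′ : W ≈M Sheared.G Y′⇄W′
    W≈G′ = IsInverse-unique Y≈Y′t′ Y⇄W (Sheared.Y⇄G Y′⇄W′)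
  image-injective {Y} {W} {Y′} {W′} Y⇄W Y′⇄W′ _ cornerDet′≉0 (yes W₀₀≈1) (no _) Yt≈Y′ =
    ⊥-elim (cornerDet′≉0 (trans (cornerDet-cong W′≈G) (Sheared.cornerDet-G≈0 Y⇄W W₀₀≈1)))
    where
    W′≈G : W′ ≈M Sheared.G Y⇄W
    W′≈G = IsInverse-unique (≈M-sym Yt≈Y′) Y′⇄W′ (Sheared.Y⇄G Y⇄W)
  image-injective {Y} {W} {Y′} {W′} Y⇄W Y′⇄W′ cornerDet≉0 _ (yes W₀₀≈1) (yes W′₀₀≈1) Yt≈Y′t′ =
    ≈M-trans (≈M-sym (unshear Y (-‿inverseʳ t)))
      (≈M-trans (*M-cong Yt≈Y′t′ (≈M-refl {x = shear (- t)}))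
                (unshear Y′ (trans (+-congʳ (sym t≈t′)) (-‿inverseʳ t))))
    where
    open Sheared Y⇄W
    module ′ = Sheared Y′⇄W′
    G′≈G : ′.G ≈M G
    G′≈G = IsInverse-unique (≈M-sym Yt≈Y′t′) ′.Y⇄G Y⇄G
    W₁₀≈W′₁₀ : W fin₁ zero ≈ W′ fin₁ zero
    W₁₀≈W′₁₀ = trans (sym G₁₀≈W₁₀) (trans (sym (G′≈G fin₁ zero)) ′.G₁₀≈W₁₀)
    t≈t′ : t ≈ ′.t
    t≈t′ = *-cancelʳ (W₁₀≉0 W₀₀≈1 cornerDet≉0) (begin
      t * W fin₁ zero      ≈⟨ 1-G₀₀≈tW₁₀ W₀₀≈1 ⟨
      1# - G zero zero     ≈⟨ +-congˡ (-‿cong (G′≈G zero zero)) ⟨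
      1# - ′.G zero zero   ≈⟨ ′.1-G₀₀≈tW₁₀ W′₀₀≈1 ⟩
      ′.t * W′ fin₁ zero   ≈⟨ *-congˡ W₁₀≈W′₁₀ ⟨
      ′.t * W fin₁ zero    ∎)

  -- A common neighbour of E₀₀ and 0 outside the image: e = I - u vᵀ with
  -- u = e₀ + e₂ and v = e₀ - e₂, whose inverse I + u vᵀ has zero corner determinant.
  u₀₂ v₀₂ : Fin n → Carrier
  u₀₂ i = δ i zero + δ i fin₂
  v₀₂ j = δ zero j - δ fin₂ j

  e W₀ : Mat n
  e  = elementary (- 1#) u₀₂ v₀₂
  W₀ = elementary 1# u₀₂ v₀₂

  e⇄W₀ : IsInverse e W₀
  e⇄W₀ = proj₁ product≈I , proj₂ product≈I
    where
    v·u≈0 : v₀₂ · u₀₂ ≈ 0#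
    v·u≈0 = begin
      sumF n (λ l → v₀₂ l * (δ l zero + δ l fin₂))
        ≈⟨ sumF-cong n (λ l → distribˡ (v₀₂ l) (δ l zero) (δ l fin₂)) ⟩
      sumF n (λ l → v₀₂ l * δ l zero + v₀₂ l * δ l fin₂)
        ≈⟨ sumF-+ n (λ l → v₀₂ l * δ l zero) (λ l → v₀₂ l * δ l fin₂) ⟩
      sumF n (λ l → v₀₂ l * δ l zero) + sumF n (λ l → v₀₂ l * δ l fin₂)
        ≈⟨ +-cong (sumF-δʳ zero v₀₂) (sumF-δʳ fin₂ v₀₂) ⟩
      (1# - 0#) + (0# - 1#)
        ≈⟨ solve 0 ((:1 :- :0) :+ (:0 :- :1) := :0) refl ⟩
      0#
        ∎
    product≈I : (e *M W₀) ≈M I × (W₀ *M e) ≈M I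
    product≈I = elementary-inverse {a = - 1#} {1#} {u₀₂} {v₀₂}
      (trans (+-cong (-‿inverseˡ 1#) (trans (*-congˡ v·u≈0) (zeroʳ _))) (+-identityʳ 0#))

  e-CommonNeighbour : CommonNeighbour E₀₀ 0M e
  e-CommonNeighbour = HasInverseWithCorner≉1⇒CommonNeighbour (W₀ , e⇄W₀ , W₀₀₀≉1)
    where
    W₀₀₀≉1 : ¬ W₀ zero zero ≈ 1#
    W₀₀₀≉1 W₀₀₀≈1 = 1≉0 (begin
      1#                          ≈⟨ solve 0 (:1 := (:1 :+ :1 :* ((:1 :+ :0) :* (:1 :- :0))) :- :1) refl ⟩
      W₀ zero zero - 1#           ≈⟨ +-congʳ W₀₀₀≈1 ⟩
      1# - 1#                     ≈⟨ -‿inverseʳ 1# ⟩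
      0#                          ∎)

  W₀₁₀≈0 : W₀ fin₁ zero ≈ 0#
  W₀₁₀≈0 = solve 0 (:0 :+ :1 :* ((:0 :+ :0) :* (:1 :- :0)) := :0) refl

  cornerDet-W₀≈0 : cornerDet W₀ ≈ 0#
  cornerDet-W₀≈0 = trans (+-cong (*-congˡ (+-congˡ (-‿cong W₀₁₁≈1))) (-‿cong (*-congˡ W₀₁₀≈0)))
    (solve 2 (λ a b → (:1 :- a) :* (:1 :- :1) :- b :* :0 := :0) refl (W₀ zero zero) (W₀ zero fin₁))
    where
    W₀₁₁≈1 : W₀ fin₁ fin₁ ≈ 1#
    W₀₁₁≈1 = solve 0 (:1 :+ :1 :* ((:0 :+ :0) :* (:0 :- :0)) := :1) refl

  image-misses-e : ∀ {Y W : Mat n} (Y⇄W : IsInverse Y W) → ¬ cornerDet W ≈ 0# →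
    (d : Dec (W zero zero ≈ 1#)) → ¬ image Y⇄W d ≈M e
  image-misses-e {Y} {W} Y⇄W cornerDet≉0 (no _) Y≈e =
    cornerDet≉0 (trans (cornerDet-cong W≈W₀) cornerDet-W₀≈0)
    where
    W≈W₀ : W ≈M W₀
    W≈W₀ = IsInverse-unique Y≈e Y⇄W e⇄W₀
  image-misses-e {Y} {W} Y⇄W cornerDet≉0 (yes W₀₀≈1) Yt≈e =
    W₁₀≉0 W₀₀≈1 cornerDet≉0 (trans (sym G₁₀≈W₁₀) (trans (G≈W₀ fin₁ zero) W₀₁₀≈0))
    where
    open Sheared Y⇄W
    G≈W₀ : G ≈M W₀
    G≈W₀ = IsInverse-unique Yt≈e Y⇄G e⇄W₀

  CommonNeighbour⇒IsInverse : ∀ Y → CommonNeighbour E₀₀+E₁₁ 0M Y →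
    Σ (Mat n) λ W → IsInverse Y W × ¬ cornerDet W ≈ 0#
  CommonNeighbour⇒IsInverse Y (B~Y , 0~Y) with UnitaryAdj-0M⇒Invertible {y = Y} 0~Y
  ... | W , YW≈I , WY≈I = W , (YW≈I , WY≈I) ,
    λ cornerDet≈0 → cornerDet≈0⇒¬UnitaryAdj {Y} {W} YW≈I cornerDet≈0 (UnitaryAdj-sym {x = E₀₀+E₁₁} {Y} B~Y)

  module _ {k k′ : ℕ} where
    open Counting (Mat-setoid n) using (HasSize-injection-missing⇒<)

    common-neighbours-E₀₀+E₁₁<E₀₀ : HasSize _≈M_ (CommonNeighbour E₀₀ 0M) k →
      HasSize _≈M_ (CommonNeighbour E₀₀+E₁₁ 0M) k′ → k′ ℕ.< k
    common-neighbours-E₀₀+E₁₁<E₀₀ size-E₀₀ size-B =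
      HasSize-injection-missing⇒< size-E₀₀ size-B f f∈ f-injective e e-CommonNeighbour f-misses-e
      where
      f : ∀ Y → CommonNeighbour E₀₀+E₁₁ 0M Y → Mat n
      f Y q = let W , Y⇄W , _ = CommonNeighbour⇒IsInverse Y q in image Y⇄W (W zero zero ≟ 1#)
      f∈ : ∀ Y q → CommonNeighbour E₀₀ 0M (f Y q)
      f∈ Y q = let W , Y⇄W , cornerDet≉0 = CommonNeighbour⇒IsInverse Y q in
        HasInverseWithCorner≉1⇒CommonNeighbour (image-HasInverseWithCorner≉1 Y⇄W cornerDet≉0 (W zero zero ≟ 1#))
      f-injective : ∀ Y q Y′ q′ → f Y q ≈M f Y′ q′ → Y ≈M Y′
      f-injective Y q Y′ q′ =
        let W , Y⇄W , cornerDet≉0 = CommonNeighbour⇒IsInverse Y q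
            W′ , Y′⇄W′ , cornerDet′≉0 = CommonNeighbour⇒IsInverse Y′ q′
        in image-injective Y⇄W Y′⇄W′ cornerDet≉0 cornerDet′≉0 (W zero zero ≟ 1#) (W′ zero zero ≟ 1#)
      f-misses-e : ∀ Y q → ¬ f Y q ≈M e
      f-misses-e Y q = let W , Y⇄W , cornerDet≉0 = CommonNeighbour⇒IsInverse Y q in
        image-misses-e Y⇄W cornerDet≉0 (W zero zero ≟ 1#)

  ¬UnitaryCayleyGraphSRG : ¬ UnitaryCayleyGraphSRG n
  ¬UnitaryCayleyGraphSRG (_ , _ , _ , _ , _ , _ , _ , non-adjacent , _ , _) =
    ℕₚ.<-irrefl ≡.refl (common-neighbours-E₀₀+E₁₁<E₀₀
      (non-adjacent E₀₀ 0M E₀₀≉0M ¬UnitaryAdj-E₀₀-0M)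
      (non-adjacent E₀₀+E₁₁ 0M E₀₀+E₁₁≉0M ¬UnitaryAdj-E₀₀+E₁₁-0M))

mainTheorem1 : ∀ {c ℓ} (F : FiniteField c ℓ) (n : ℕ) → 1 ≤ n →
    (Matrices.UnitaryCayleyGraphSRG F n ⇔ n ≡ 2)
mainTheorem1 F n 1≤n = mk⇔ (strongly-regular⇒n≡2 n 1≤n) λ { ≡.refl → TwoByTwo.unitaryCayleyGraph₂-SRG F }
  where
  strongly-regular⇒n≡2 : ∀ n → 1 ≤ n → Matrices.UnitaryCayleyGraphSRG F n → n ≡ 2
  strongly-regular⇒n≡2 zero                   ()
  strongly-regular⇒n≡2 (suc zero)             _ srg = ⊥-elim (CayleyGraph.¬UnitaryCayleyGraphSRG₁ F srg)
  strongly-regular⇒n≡2 (suc (suc zero))       _ _   = ≡.refl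
  strongly-regular⇒n≡2 (suc (suc (suc m)))    _ srg = ⊥-elim (DimensionAtLeastThree.¬UnitaryCayleyGraphSRG F m srg)
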